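{- Let $(\mathcal{A},\varphi,\varphi^\prime)$ be an infinitesimal non-commutative probability space, $\Phi,\Phi^\prime:H\to\mathbb{C}$ its extensions and $\tilde\Phi=\Phi+\hbar\Phi^\prime$ the associated $\mathbb{G}$-valued character. Let $\tilde\kappa=\kappa+\hbar\kappa^\prime$ and $\tilde\beta=\beta+\hbar\beta^\prime$ be the $\mathbb{G}$-valued infinitesimal characters solving $\tilde\Phi=\tilde\varepsilon+\tilde\kappa\prec\tilde\Phi$ and $\tilde\Phi=\tilde\varepsilon+\tilde\Phi\succ\tilde\beta$. Then for every word $w=a_1\cdots a_n\in T_+(\mathcal{A})$, $\kappa^\prime(w)=r^\prime_n(a_1,\dots,a_n)$ and $\beta^\prime(w)=b^\prime_n(a_1,\dots,a_n)$, the infinitesimal free and infinitesimal Boolean cumulants.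
   Context: An infinitesimal non-commutative probability space is $(\mathcal{A},\varphi,\varphi^\prime)$ with $\mathcal{A}$ a unital complex algebra, $\varphi,\varphi^\prime$ linear functionals, $\varphi(1)=1$, $\varphi^\prime(1)=0$; $\varphi_n(a_1,\dots,a_n)=\varphi(a_1\cdots a_n)$, $\varphi^\prime_n$ similarly. Free cumulants $r_n$, Boolean cumulants $b_n$ and infinitesimal ones are defined recursively by $\varphi_n=\sum_{\pi\in\mathcal{NC}(n)}r_\pi$, $\varphi^\prime_n=\sum_{\pi\in\mathcal{NC}(n)}\partial r_\pi$, $\varphi_n=\sum_{\pi\in\mathcal{I}(n)}b_\pi$, $\varphi^\prime_n=\sum_{\pi\in\mathcal{I}(n)}\partial b_\pi$, where $\mathcal{NC}(n)$, $\mathcal{I}(n)$ are non-crossing resp. interval partitions of $[n]$, $f_\pi(a_1,\dots,a_n)=\prod_{V\in\pi}f_{|V|}(a_V)$ ($a_V$ = entries indexed by $V$ in increasing order) and $\partial f_\pi=\sum_{V\in\pi}f^\prime_{|V|}(a_V)\prod_{W\ne V}f_{|W|}(a_W)$. $\mathbb{G}=\{z+\hbar w\}$ with $\hbar^2=0$. $H=T(T_+(\mathcal{A}))$ is the double tensor algebra: words $a_1\cdots a_n\in\mathcal{A}^{\otimes n}$, product $w_1|w_2$, unit $\mathbf1$. For $S\subseteq[n]$, $a_S$ is the subword indexed by $S$ ($a_\emptyset=\mathbf 1$), $J_1,\dots,J_k$ the maximal intervals of $[n]\setminus S$ in order; $\Delta(a_1\cdots a_n)=\sum_{S\subseteq[n]}a_S\otimes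 a_{J_1}|\cdots|a_{J_k}$ (multiplicative, $\Delta(\mathbf1)=\mathbf1\otimes\mathbf1$), $\Delta_\prec$ (resp. $\Delta_\succ$) the part with $1\in S$ (resp. $1\notin S$), extended by $\Delta_{\prec/\succ}(w_1|w_2)=\Delta_{\prec/\succ}(w_1)\Delta(w_2)$. For linear $f,g:H\to\mathbb{G}$: $f\prec g=m_\mathbb{G}(f\otimes g)\Delta_\prec$, $f\succ g=m_\mathbb{G}(f\otimes g)\Delta_\succ$; $\tilde\varepsilon(\mathbf 1)=1$, $\tilde\varepsilon=0$ on nonempty words and their products. Infinitesimal characters vanish on $\mathbf 1$ and on all products $w_1|w_2$ of non-unit elements. The extensions: $\Phi$ is the character ($\Phi(\mathbf1)=1$, multiplicative) with $\Phi(a_1\cdots a_n)=\varphi(a_1\cdots a_n)$; $\Phi^\prime$ is linear with $\Phi^\prime(a_1\cdots a_n)=\varphi^\prime(a_1\cdots a_n)$, $\Phi^\prime(\mathbf 1)=0$ and $\Phi^\prime(w_1|w_2)=\Phi(w_1)\Phi^\prime(w_2)+\Phi^\prime(w_1)\Phi(w_2)$. Then $\tilde\Phi=\Phi+\hbar\Phi^\prime$ is multiplicative; $\kappa,\kappa^\prime,\beta,\beta^\prime$ denote the $\mathbb{C}$-valued components. -}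

module Defs where

open import Level using (Level; _⊔_)
open import Data.Bool using (Bool; true; false; _∧_; _∨_)
open import Data.Nat using (ℕ; zero; suc; _<ᵇ_; _≡ᵇ_)
open import Data.Product using (_×_; _,_; proj₁; proj₂)
open import Data.List using (List; []; _∷_; _++_; map; concatMap; foldr; length; upTo; zip)
open import Data.Bool.ListAction using (any; all)
open import Data.List.NonEmpty using (List⁺; _∷_; toList) renaming (map to map⁺)
open import Algebra.Bundles using (CommutativeRing; Monoid)

-- Everything is parameterised by
--   R : a commutative ring (stand-in for the scalar field ℂ, which is not
--       available in agda-stdlib), and
--   M : the (multiplicative monoid of the) unital algebra 𝒜.

module Setup {c ℓ a m : Level} (R : CommutativeRing c ℓ) (M : Monoid a m) where

  open CommutativeRing R using (_+_; _*_; -_; 0#; 1#; _≈_) renaming (Carrier to ℝ)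
  open Monoid M using (_∙_; ε) renaming (Carrier to 𝒜)

  -- Dual numbers 𝔾 = { z + ħ w } with ħ² = 0, as pairs (z , w).
  𝔾 : Set c
  𝔾 = ℝ × ℝ

  _+𝔾_ : 𝔾 → 𝔾 → 𝔾
  (z , w) +𝔾 (z' , w') = (z + z' , w + w')

  _*𝔾_ : 𝔾 → 𝔾 → 𝔾
  (z , w) *𝔾 (z' , w') = (z * z' , (z * w') + (w * z'))

  0𝔾 1𝔾 : 𝔾
  0𝔾 = (0# , 0#)
  1𝔾 = (1# , 0#)

  _≈𝔾_ : 𝔾 → 𝔾 → Set ℓ
  (z , w) ≈𝔾 (z' , w') = (z ≈ z') × (w ≈ w')

  sum𝔾 : List 𝔾 → 𝔾
  sum𝔾 = foldr _+𝔾_ 0𝔾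

  sumℝ : List ℝ → ℝ
  sumℝ = foldr _+_ 0#

  -- Words a₁⋯aₙ ∈ 𝒜^{⊗n} (n ≥ 1) and pure elements of H = T(T₊(𝒜)):
  -- w₁|⋯|w_k is the list (w₁ ∷ ⋯ ∷ w_k); the unit 𝟏 is the empty list.
  -- A (linear) map H → 𝔾 is given by its values on these spanning elements.
  Word : Set a
  Word = List⁺ 𝒜

  H : Set a
  H = List Word

  𝟏 : H
  𝟏 = []

  prodA : Word → 𝒜
  prodA w = foldr _∙_ ε (toList w)

  -- The coproduct Δ.  A subset S ⊆ [n] is a Boolean mask of length n.
  masks : ℕ → List (List Bool)
  masks zero    = [] ∷ []
  masks (suc n) = map (true ∷_) (masks n) ++ map (false ∷_) (masks n)

  close : List 𝒜 → H
  close []       = []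
  close (x ∷ xs) = (x ∷ xs) ∷ []

  sel : List Bool → List 𝒜 → List 𝒜
  sel (true  ∷ bs) (x ∷ xs) = x ∷ sel bs xs
  sel (false ∷ bs) (x ∷ xs) = sel bs xs
  sel _            _        = []

  -- a_{J₁}|⋯|a_{J_k} for the maximal intervals J_i of [n] ∖ S
  runsAcc : List 𝒜 → List Bool → List 𝒜 → H
  runsAcc cur (true  ∷ bs) (x ∷ xs) = close cur ++ runsAcc [] bs xs
  runsAcc cur (false ∷ bs) (x ∷ xs) = runsAcc (cur ++ (x ∷ [])) bs xs
  runsAcc cur _            _        = close cur

  Term : Set a
  Term = H × H          -- a pure tensor  x ⊗ y  in H ⊗ H

  term : List Bool → Word → Term
  term S w = (close (sel S (toList w)) , runsAcc [] S (toList w))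

  -- product in H ⊗ H of two sums of pure tensors
  mulTerms : List Term → List Term → List Term
  mulTerms xs ys = concatMap (λ t → map (λ t' → (proj₁ t ++ proj₁ t' , proj₂ t ++ proj₂ t')) ys) xs

  -- Δ≺ (1 ∈ S) and Δ≻ (1 ∉ S) on a single word
  Δ≺w Δ≻w Δw : Word → List Term
  Δ≺w (x ∷ xs) = map (λ S → term (true  ∷ S) (x ∷ xs)) (masks (length xs))
  Δ≻w (x ∷ xs) = map (λ S → term (false ∷ S) (x ∷ xs)) (masks (length xs))
  Δw w = Δ≺w w ++ Δ≻w w

  Δ : H → List Term
  Δ []       = ([] , []) ∷ []
  Δ (w ∷ ws) = mulTerms (Δw w) (Δ ws)

  -- Δ≺/≻(w₁|w₂) = Δ≺/≻(w₁) Δ(w₂);  (not defined on 𝟏: taken to be 0)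
  Δ≺ Δ≻ : H → List Term
  Δ≺ []       = []
  Δ≺ (w ∷ ws) = mulTerms (Δ≺w w) (Δ ws)
  Δ≻ []       = []
  Δ≻ (w ∷ ws) = mulTerms (Δ≻w w) (Δ ws)

  convWith : List Term → (H → 𝔾) → (H → 𝔾) → 𝔾
  convWith ts f g = sum𝔾 (map (λ t → f (proj₁ t) *𝔾 g (proj₂ t)) ts)

  _≺_ _≻_ : (H → 𝔾) → (H → 𝔾) → H → 𝔾
  (f ≺ g) x = convWith (Δ≺ x) f g
  (f ≻ g) x = convWith (Δ≻ x) f g

  ε̃ : H → 𝔾
  ε̃ []      = 1𝔾
  ε̃ (_ ∷ _) = 0𝔾

  IsInfChar : (H → 𝔾) → Set (a ⊔ ℓ)
  IsInfChar κ = (κ [] ≈𝔾 0𝔾) × (∀ (w₁ w₂ : Word) (ws : H) → κ (w₁ ∷ w₂ ∷ ws) ≈𝔾 0𝔾)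

  module Ext (φ φ′ : 𝒜 → ℝ) where

    Φ : H → ℝ
    Φ []       = 1#
    Φ (w ∷ ws) = φ (prodA w) * Φ ws

    Φ′ : H → ℝ
    Φ′ []       = 0#
    Φ′ (w ∷ ws) = (φ (prodA w) * Φ′ ws) + (φ′ (prodA w) * Φ ws)

    Φ̃ : H → 𝔾
    Φ̃ x = (Φ x , Φ′ x)

  -- Set partitions of a list; blocks stay in increasing order.
  insertEach : {X : Set a} → X → List (List⁺ X) → List (List (List⁺ X))
  insertEach x []       = []
  insertEach x (B ∷ Bs) = ((x ∷ toList B) ∷ Bs) ∷ map (B ∷_) (insertEach x Bs)

  partitions : {X : Set a} → List X → List (List (List⁺ X))
  partitions []       = [] ∷ []
  partitions (x ∷ xs) = concatMap (λ p → ((x ∷ []) ∷ p) ∷ insertEach x p) (partitions xs)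

  -- letters of a word labelled by their positions 0,…,n-1
  Pos : Set a
  Pos = ℕ × 𝒜

  labelled : Word → List Pos
  labelled w = zip (upTo (length (toList w))) (toList w)

  Partition : Set a
  Partition = List (List⁺ Pos)

  idx : List⁺ Pos → List ℕ
  idx B = map proj₁ (toList B)

  crosses : List⁺ Pos → List⁺ Pos → Bool
  crosses V W = any (λ x → any (λ y → any (λ z → any (λ t →
                   (x <ᵇ y) ∧ ((y <ᵇ z) ∧ (z <ᵇ t))) (idx W)) (idx V)) (idx W)) (idx V)

  distinctPairs : Partition → List (List⁺ Pos × List⁺ Pos)
  distinctPairs []       = []
  distinctPairs (B ∷ Bs) = map (B ,_) Bs ++ map (_, B) Bs ++ distinctPairs Bs

  isNonCrossing : Partition → Bool
  isNonCrossing π = all (λ p → Data.Bool.not (crosses (proj₁ p) (proj₂ p))) (distinctPairs π)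
    where import Data.Bool

  consecutive : List ℕ → Bool
  consecutive (x ∷ y ∷ zs) = (suc x ≡ᵇ y) ∧ consecutive (y ∷ zs)
  consecutive _            = true

  isInterval : Partition → Bool
  isInterval π = all (λ B → consecutive (idx B)) π

  filterB : {X : Set a} → (X → Bool) → List X → List X
  filterB p []       = []
  filterB p (x ∷ xs) with p x
  ... | true  = x ∷ filterB p xs
  ... | false = filterB p xs

  NC 𝓘 : Word → List Partition
  NC w = filterB isNonCrossing (partitions (labelled w))
  𝓘  w = filterB isInterval    (partitions (labelled w))

  sub : List⁺ Pos → Word
  sub V = map⁺ proj₂ V

  prodπ : (Word → ℝ) → Partition → ℝ
  prodπ f π = foldr (λ V r → f (sub V) * r) 1# π

  -- ∂f_π = ∑_{V ∈ π} f′(a_V) ∏_{W ≠ V} f(a_W)   (written recursively)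
  dprodπ : (Word → ℝ) → (Word → ℝ) → Partition → ℝ
  dprodπ f f′ []       = 0#
  dprodπ f f′ (V ∷ Vs) = (f′ (sub V) * prodπ f Vs) + (f (sub V) * dprodπ f f′ Vs)

  -- Cumulants, characterised by their defining moment–cumulant relations
  -- (these relations determine them uniquely by recursion on n).
  module Cumulants (φ φ′ : 𝒜 → ℝ) where

    IsFreeCumulants : (Word → ℝ) → Set (a ⊔ ℓ)
    IsFreeCumulants r = ∀ w → φ (prodA w) ≈ sumℝ (map (prodπ r) (NC w))

    IsInfFreeCumulants : (Word → ℝ) → (Word → ℝ) → Set (a ⊔ ℓ)
    IsInfFreeCumulants r r′ = ∀ w → φ′ (prodA w) ≈ sumℝ (map (dprodπ r r′) (NC w))

    IsBooleanCumulants : (Word → ℝ) → Set (a ⊔ ℓ)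
    IsBooleanCumulants b = ∀ w → φ (prodA w) ≈ sumℝ (map (prodπ b) (𝓘 w))

    IsInfBooleanCumulants : (Word → ℝ) → (Word → ℝ) → Set (a ⊔ ℓ)
    IsInfBooleanCumulants b b′ = ∀ w → φ′ (prodA w) ≈ sumℝ (map (dprodπ b b′) (𝓘 w))

module Submission where

-- Write ρ = c + ħ c′ for a cumulant family together with its infinitesimal companion.  The rule
-- for ∂f_π is the ħ-part of a product in the dual numbers 𝔾, so the moment–cumulant relations
-- say that Φ̃ on a word is the sum over noncrossing (resp. interval) partitions of the product
-- of the ρ-values of the blocks.  Grouping these partitions by the block containing the first
-- letter gives the recursions
--   Φ̃(a₁⋯aₙ) = Σ_{1 ∈ S} ρ(a_S) Φ̃(a_{J₁})⋯Φ̃(a_{J_k})   and   Φ̃(a₁⋯aₙ) = Σ_k ρ(a₁⋯a_k) Φ̃(a_{k+1}⋯aₙ),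
-- which are exactly what Φ̃ = ε̃ + κ̃ ≺ Φ̃ and Φ̃ = ε̃ + Φ̃ ≻ β̃ say on a single word (in the
-- second case because β̃ kills products of two or more words).  Either recursion determines the
-- weight of the first block by induction on the length of the word, so κ̃ = r + ħ r′ and
-- β̃ = b + ħ b′ on words.  For noncrossing partitions the grouping is obtained by matching the
-- enumeration `partitions`, which inserts letters in front, against a left-to-right stack machine.

open import Defs
open import Level using (Level)
open import Data.Product using (_×_; _,_; proj₁; proj₂)
open import Data.List using (List; []; _∷_)
open import Algebra.Bundles using (CommutativeRing; Monoid)

module ListLemmas where

  open import Level using (Level)
  open import Data.Bool using (Bool; true; false; _∧_; _∨_; T)
  open import Data.Bool.Properties using (∧-assoc)
  open import Data.Bool.ListAction using (any; all)
  open import Data.Nat using (zero; suc; _<_; _≤_; _<ᵇ_; _≡ᵇ_)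
  open import Data.Nat.Properties using (<⇒<ᵇ; <ᵇ⇒<; <⇒≱; ≡ᵇ⇒≡)
  open import Data.Product using (_×_; _,_; ∃)
  open import Data.List using ([]; _∷_; _++_; map)
  open import Data.List.Relation.Unary.All as All using (All; []; _∷_)
  open import Data.List.Membership.Propositional.Properties using (∈-++⁺ʳ)
  open import Data.List.Relation.Unary.AllPairs using (AllPairs; _∷_)
  open import Relation.Unary using (Pred)
  open import Relation.Binary.Core using (Rel)
  open import Data.List.Relation.Unary.Any using (here; there)
  open import Data.List.Membership.Propositional using (_∈_)
  open import Relation.Binary.PropositionalEquality using (_≡_; _≢_; refl; sym; cong; cong₂; subst)
  open import Data.Empty using (⊥-elim)

  private variable
    b p r : Level
    A C : Set b

  <ᵇ-asym : ∀ x y → (x <ᵇ y) ∧ (y <ᵇ x) ≡ false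
  <ᵇ-asym zero    zero    = refl
  <ᵇ-asym zero    (suc y) = refl
  <ᵇ-asym (suc x) zero    = refl
  <ᵇ-asym (suc x) (suc y) = <ᵇ-asym x y

  <⇒<ᵇ≡true : ∀ {x y} → x < y → (x <ᵇ y) ≡ true
  <⇒<ᵇ≡true {x} {y} x<y with x <ᵇ y | <⇒<ᵇ x<y
  ... | true | _ = refl

  ≤⇒>ᵇ≡false : ∀ {x y} → y ≤ x → (x <ᵇ y) ≡ false
  ≤⇒>ᵇ≡false {x} {y} y≤x with x <ᵇ y | <ᵇ⇒< x y
  ... | false | _ = refl
  ... | true  | x<y = ⊥-elim (<⇒≱ (x<y _) y≤x)

  any-false : ∀ {p : A → Bool} {xs} → All (λ x → p x ≡ false) xs → any p xs ≡ false
  any-false []                = refl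
  any-false (px≡false ∷ rest) rewrite px≡false = any-false rest

  any-true : ∀ {p : A → Bool} {xs x} → x ∈ xs → p x ≡ true → any p xs ≡ true
  any-true {xs = x ∷ xs} (here refl) px≡true rewrite px≡true = refl
  any-true {p = p} {x ∷ xs} (there x∈) px≡true with p x
  ... | true  = refl
  ... | false = any-true x∈ px≡true

  any-true⁻ : ∀ {p : A → Bool} xs → any p xs ≡ true → ∃ λ x → x ∈ xs × p x ≡ true
  any-true⁻ {p = p} (x ∷ xs) any≡true with p x in px≡
  ... | true  = x , here refl , px≡
  ... | false with any-true⁻ xs any≡true
  ...   | y , y∈ , py≡ = y , there y∈ , py≡

  any-cong : ∀ {p q : A → Bool} {xs} → All (λ x → p x ≡ q x) xs → any p xs ≡ any q xs
  any-cong []           = refl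
  any-cong (px≡qx ∷ es) = cong₂ _∨_ px≡qx (any-cong es)

  all-cong : ∀ {p q : A → Bool} {xs} → All (λ x → p x ≡ q x) xs → all p xs ≡ all q xs
  all-cong []           = refl
  all-cong (px≡qx ∷ es) = cong₂ _∧_ px≡qx (all-cong es)

  all-true : ∀ {p : A → Bool} {xs} → All (λ x → p x ≡ true) xs → all p xs ≡ true
  all-true []               = refl
  all-true (px≡true ∷ rest) rewrite px≡true = all-true rest

  all-false : ∀ {p : A → Bool} {xs x} → x ∈ xs → p x ≡ false → all p xs ≡ false
  all-false {xs = x ∷ xs} (here refl) px≡false rewrite px≡false = refl
  all-false {p = p} {x ∷ xs} (there x∈) px≡false with p x
  ... | true  = all-false x∈ px≡false
  ... | false = refl

  all-true⁻ : ∀ {p : A → Bool} xs {x} → all p xs ≡ true → x ∈ xs → p x ≡ true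
  all-true⁻ {p = p} (y ∷ xs) all≡true x∈ with p y in py≡
  all-true⁻ (y ∷ xs) all≡true (here refl) | true = py≡
  all-true⁻ (y ∷ xs) all≡true (there x∈)  | true = all-true⁻ xs all≡true x∈

  all-++ : ∀ (p : A → Bool) xs ys → all p (xs ++ ys) ≡ all p xs ∧ all p ys
  all-++ p []       ys = refl
  all-++ p (x ∷ xs) ys rewrite all-++ p xs ys = sym (∧-assoc (p x) _ _)

  all-map : ∀ (p : A → Bool) (f : C → A) xs → all p (map f xs) ≡ all (λ x → p (f x)) xs
  all-map p f []       = refl
  all-map p f (x ∷ xs) = cong (p (f x) ∧_) (all-map p f xs)

  module _ {P : Pred A p} where

    All-replace : ∀ pre {x x′ post} → All P (pre ++ x ∷ post) → P x′ → All P (pre ++ x′ ∷ post)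
    All-replace []      (_ ∷ pxs)  px′ = px′ ∷ pxs
    All-replace (_ ∷ pre) (pw ∷ pxs) px′ = pw ∷ All-replace pre pxs px′

  module _ {R : Rel A r} where

    AllPairs-split : ∀ pre {x post} → AllPairs R (pre ++ x ∷ post) → All (λ w → R w x) pre × All (R x) post
    AllPairs-split []        (Rx ∷ _)    = [] , Rx
    AllPairs-split (w ∷ pre) (Rw ∷ rest) with AllPairs-split pre rest
    ... | below , above = All.lookup Rw (∈-++⁺ʳ pre (here refl)) ∷ below , above

    AllPairs-replace : ∀ pre {x x′ post} → (∀ {w} → R w x → R w x′) → (∀ {w} → R x w → R x′ w)
                     → AllPairs R (pre ++ x ∷ post) → AllPairs R (pre ++ x′ ∷ post)
    AllPairs-replace []        _    Rx⇒ (Rx ∷ rest) = All.map Rx⇒ Rx ∷ rest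
    AllPairs-replace (w ∷ pre) ⇒Rx Rx⇒ (Rw ∷ rest) =
      All-replace pre Rw (⇒Rx (All.lookup Rw (∈-++⁺ʳ pre (here refl)))) ∷ AllPairs-replace pre ⇒Rx Rx⇒ rest

  ≡ᵇ-refl : ∀ n → (n ≡ᵇ n) ≡ true
  ≡ᵇ-refl zero    = refl
  ≡ᵇ-refl (suc n) = ≡ᵇ-refl n

  ≢⇒≡ᵇ≡false : ∀ {m n} → m ≢ n → (m ≡ᵇ n) ≡ false
  ≢⇒≡ᵇ≡false {m} {n} m≢n with m ≡ᵇ n in m≡ᵇn
  ... | false = refl
  ... | true  = ⊥-elim (m≢n (≡ᵇ⇒≡ m n (subst T (sym m≡ᵇn) _)))


module RingSums {c ℓ} (G : CommutativeRing c ℓ) where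

  open import Level using (Level)
  open import Data.List using (List; []; _∷_; _++_; map; concatMap; foldr)
  open import Data.List.Properties using (map-++)
  open import Data.List.Relation.Unary.All using (All; []; _∷_)
  import Relation.Binary.PropositionalEquality as ≡

  open CommutativeRing G
  open import Algebra.Properties.CommutativeSemigroup +-commutativeSemigroup using (interchange)

  private variable
    b : Level
    A B : Set b

  sum : List Carrier → Carrier
  sum = foldr _+_ 0#

  sum-++ : ∀ xs ys → sum (xs ++ ys) ≈ sum xs + sum ys
  sum-++ []       ys = sym (+-identityˡ _)
  sum-++ (x ∷ xs) ys = trans (+-cong refl (sum-++ xs ys)) (sym (+-assoc _ _ _))

  sum-map-cong : ∀ {f g : A → Carrier} → (∀ x → f x ≈ g x) → ∀ xs → sum (map f xs) ≈ sum (map g xs)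
  sum-map-cong f≈g []       = refl
  sum-map-cong f≈g (x ∷ xs) = +-cong (f≈g x) (sum-map-cong f≈g xs)

  sum-map-cong-local : ∀ {f g : A → Carrier} {xs} → All (λ x → f x ≈ g x) xs → sum (map f xs) ≈ sum (map g xs)
  sum-map-cong-local []           = refl
  sum-map-cong-local (fx≈gx ∷ es) = +-cong fx≈gx (sum-map-cong-local es)

  sum-concatMap : ∀ (f : B → Carrier) (g : A → List B) xs
                → sum (map f (concatMap g xs)) ≈ sum (map (λ x → sum (map f (g x))) xs)
  sum-concatMap f g []       = refl
  sum-concatMap f g (x ∷ xs) = begin
    sum (map f (g x ++ concatMap g xs))           ≈⟨ reflexive (≡.cong sum (map-++ f (g x) _)) ⟩
    sum (map f (g x) ++ map f (concatMap g xs))   ≈⟨ sum-++ (map f (g x)) _ ⟩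
    sum (map f (g x)) + sum (map f (concatMap g xs)) ≈⟨ +-cong refl (sum-concatMap f g xs) ⟩
    _ ∎
    where open import Relation.Binary.Reasoning.Setoid setoid

  sum-zero : ∀ (xs : List A) → sum (map (λ _ → 0#) xs) ≈ 0#
  sum-zero []       = refl
  sum-zero (x ∷ xs) = trans (+-identityˡ _) (sum-zero xs)

  sum-*ˡ : ∀ x (f : A → Carrier) xs → sum (map (λ y → x * f y) xs) ≈ x * sum (map f xs)
  sum-*ˡ x f []       = sym (zeroʳ x)
  sum-*ˡ x f (y ∷ ys) = trans (+-cong refl (sum-*ˡ x f ys)) (sym (distribˡ _ _ _))

  sum-+ : ∀ (f g : A → Carrier) xs → sum (map (λ x → f x + g x) xs) ≈ sum (map f xs) + sum (map g xs)
  sum-+ f g []       = sym (+-identityˡ _)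
  sum-+ f g (x ∷ xs) = trans (+-cong refl (sum-+ f g xs)) (interchange _ _ _ _)


module DualNumbers {c ℓ a m} (R : CommutativeRing c ℓ) (M : Monoid a m) where

  open import Data.Product using (_,_)
  open import Algebra.Structures using (IsCommutativeRing)
  open Setup R M using (𝔾; _+𝔾_; _*𝔾_; 0𝔾; 1𝔾; _≈𝔾_)
  open CommutativeRing R
  open import Algebra.Solver.Ring.NaturalCoefficients.Default commutativeSemiring

  -𝔾_ : 𝔾 → 𝔾
  -𝔾 (z , w) = (- z , - w)

  dual-isCommutativeRing : IsCommutativeRing _≈𝔾_ _+𝔾_ _*𝔾_ -𝔾_ 0𝔾 1𝔾
  dual-isCommutativeRing = record
    { isRing = record
      { +-isAbelianGroup = record
        { isGroup = record
          { isMonoid = record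
            { isSemigroup = record
              { isMagma = record
                { isEquivalence = record
                  { refl  = refl , refl
                  ; sym   = λ (p , q) → sym p , sym q
                  ; trans = λ (p , q) (p′ , q′) → trans p p′ , trans q q′ }
                ; ∙-cong = λ (p , q) (p′ , q′) → +-cong p p′ , +-cong q q′ }
              ; assoc = λ _ _ _ → +-assoc _ _ _ , +-assoc _ _ _ }
            ; identity = (λ _ → +-identityˡ _ , +-identityˡ _) , (λ _ → +-identityʳ _ , +-identityʳ _) }
          ; inverse = (λ _ → -‿inverseˡ _ , -‿inverseˡ _) , (λ _ → -‿inverseʳ _ , -‿inverseʳ _)
          ; ⁻¹-cong = λ (p , q) → -‿cong p , -‿cong q }
        ; comm = λ _ _ → +-comm _ _ , +-comm _ _ }
      ; *-cong = λ (p , q) (p′ , q′) → *-cong p p′ , +-cong (*-cong p q′) (*-cong q p′)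
      ; *-assoc = λ (a , b) (c , d) (e , f) → *-assoc _ _ _ ,
          solve 6 (λ a b c d e f → (a :* c) :* f :+ (a :* d :+ b :* c) :* e
                                := a :* (c :* f :+ d :* e) :+ b :* (c :* e)) refl a b c d e f
      ; *-identity = (λ (a , b) → *-identityˡ _ , solve 2 (λ a b → con 1 :* b :+ con 0 :* a := b) refl a b)
                   , (λ (a , b) → *-identityʳ _ , solve 2 (λ a b → a :* con 0 :+ b :* con 1 := b) refl a b)
      ; distrib = (λ (a , b) (c , d) (e , f) → distribˡ _ _ _ ,
                    solve 6 (λ a b c d e f → a :* (d :+ f) :+ b :* (c :+ e)
                                          := (a :* d :+ b :* c) :+ (a :* f :+ b :* e)) refl a b c d e f)
                , (λ (a , b) (c , d) (e , f) → distribʳ _ _ _ ,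
                    solve 6 (λ a b c d e f → (c :+ e) :* b :+ (d :+ f) :* a
                                          := (c :* b :+ d :* a) :+ (e :* b :+ f :* a)) refl a b c d e f)
      }
    ; *-comm = λ (a , b) (c , d) → *-comm _ _ ,
        solve 4 (λ a b c d → a :* d :+ b :* c := c :* b :+ d :* a) refl a b c d
    }

  dualRing : CommutativeRing c ℓ
  dualRing = record { isCommutativeRing = dual-isCommutativeRing }


module Expansions {c ℓ a} (G : CommutativeRing c ℓ) (𝒜 : Set a) where

  open import Level using (_⊔_)
  open import Data.Nat using (suc; _<_; _≤_; z≤n; s≤s)
  open import Data.Nat.Properties using (≤-refl; ≤-trans; n≤1+n)
  open import Data.List using (List; []; _∷_; length)

  open CommutativeRing G
  open import Algebra.Properties.CommutativeSemigroup +-commutativeSemigroup using (interchange)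
  open import Algebra.Properties.CommutativeSemigroup *-commutativeSemigroup using (x∙yz≈y∙xz)
  open import Algebra.Properties.Group +-group using () renaming (∙-cancelʳ to +-cancelʳ)
  open import Relation.Binary.Reasoning.Setoid setoid

  Weight : Set (a ⊔ c)
  Weight = List 𝒜 → Carrier

  _▹_ : Weight → 𝒜 → Weight
  (h ▹ z) u = h (z ∷ u)

  -- Sum over all S ⊆ L of  h(L_S) · F(J₀) · N(J₁) ⋯ N(J_k),  where J₀, J₁, …, J_k are the
  -- (possibly empty) gaps of S in L, J₀ being the one before the first element of S.
  firstBlockExpansion : Weight → Weight → Weight → List 𝒜 → Carrier
  firstBlockExpansion N F h []       = h [] * F []
  firstBlockExpansion N F h (z ∷ zs) =
    F [] * firstBlockExpansion N N (h ▹ z) zs + firstBlockExpansion N (λ J → F (z ∷ J)) h zs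

  -- Sum over all splittings L = L₁ L₂ of  h(L₁) · N(L₂), with N(L₂) read as 1 when L₂ is empty.
  firstIntervalExpansion : Weight → Weight → List 𝒜 → Carrier
  firstIntervalExpansion N h []       = h []
  firstIntervalExpansion N h (z ∷ zs) = h [] * N (z ∷ zs) + firstIntervalExpansion N (h ▹ z) zs

  firstBlockExpansion-cong : ∀ {N N′ F F′} h L → (∀ J → N J ≈ N′ J) → (∀ J → F J ≈ F′ J)
                           → firstBlockExpansion N F h L ≈ firstBlockExpansion N′ F′ h L
  firstBlockExpansion-cong h []       N≈ F≈ = *-cong refl (F≈ [])
  firstBlockExpansion-cong h (z ∷ zs) N≈ F≈ =
    +-cong (*-cong (F≈ []) (firstBlockExpansion-cong (h ▹ z) zs N≈ N≈))
           (firstBlockExpansion-cong h zs N≈ (λ J → F≈ (z ∷ J)))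

  firstBlockExpansion-+ : ∀ N F F′ h L → firstBlockExpansion N (λ J → F J + F′ J) h L
                                      ≈ firstBlockExpansion N F h L + firstBlockExpansion N F′ h L
  firstBlockExpansion-+ N F F′ h []       = distribˡ _ _ _
  firstBlockExpansion-+ N F F′ h (z ∷ zs) =
    trans (+-cong (distribʳ _ _ _) (firstBlockExpansion-+ N _ _ h zs)) (interchange _ _ _ _)

  firstBlockExpansion-*ˡ : ∀ N x F h L → firstBlockExpansion N (λ J → x * F J) h L
                                       ≈ x * firstBlockExpansion N F h L
  firstBlockExpansion-*ˡ N x F h []       = x∙yz≈y∙xz _ _ _
  firstBlockExpansion-*ˡ N x F h (z ∷ zs) =
    trans (+-cong (*-assoc _ _ _) (firstBlockExpansion-*ˡ N x _ h zs)) (sym (distribˡ _ _ _))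

  firstBlockExpansion-zero : ∀ N h L → firstBlockExpansion N (λ _ → 0#) h L ≈ 0#
  firstBlockExpansion-zero N h []       = zeroʳ _
  firstBlockExpansion-zero N h (z ∷ zs) =
    trans (+-cong (zeroˡ _) (firstBlockExpansion-zero N h zs)) (+-identityˡ _)

  firstBlockExpansion-local : ∀ N F {h h′} L → (∀ u → length u ≤ length L → h u ≈ h′ u)
                            → firstBlockExpansion N F h L ≈ firstBlockExpansion N F h′ L
  firstBlockExpansion-local N F []       h≈ = *-cong (h≈ [] z≤n) refl
  firstBlockExpansion-local N F (z ∷ zs) h≈ =
    +-cong (*-cong refl (firstBlockExpansion-local N N zs (λ u |u|≤ → h≈ (z ∷ u) (s≤s |u|≤))))
           (firstBlockExpansion-local N _ zs (λ u |u|≤ → h≈ u (≤-trans |u|≤ (n≤1+n _))))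

  -- The term S = L is h(L)·N([])ᵏ, and every other term only involves h on shorter words.
  firstBlockExpansion-injective : ∀ N {h h′} L → N [] ≈ 1# → (∀ u → length u < length L → h u ≈ h′ u)
                                → firstBlockExpansion N N h L ≈ firstBlockExpansion N N h′ L → h L ≈ h′ L
  firstBlockExpansion-injective N []       N[]≈1 h≈ eq = begin
    _      ≈⟨ sym (*-identityʳ _) ⟩
    _ * 1# ≈⟨ *-cong refl (sym N[]≈1) ⟩
    _      ≈⟨ eq ⟩
    _ * N [] ≈⟨ *-cong refl N[]≈1 ⟩
    _ * 1# ≈⟨ *-identityʳ _ ⟩
    _ ∎
  firstBlockExpansion-injective N (z ∷ zs) N[]≈1 h≈ eq =
    firstBlockExpansion-injective N zs N[]≈1 (λ u |u|< → h≈ (z ∷ u) (s≤s |u|<)) (begin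
      _                    ≈⟨ sym (*-identityˡ _) ⟩
      1# * _               ≈⟨ *-cong (sym N[]≈1) refl ⟩
      N [] * _             ≈⟨ +-cancelʳ _ _ _ (trans eq (+-cong refl rest≈)) ⟩
      N [] * _             ≈⟨ *-cong N[]≈1 refl ⟩
      1# * _               ≈⟨ *-identityˡ _ ⟩
      _                    ∎)
    where
    rest≈ = firstBlockExpansion-local N _ zs (λ u |u|≤ → sym (h≈ u (s≤s |u|≤)))

  firstIntervalExpansion-cong : ∀ {N N′ h h′} L → (∀ J → N J ≈ N′ J) → (∀ u → h u ≈ h′ u)
                              → firstIntervalExpansion N h L ≈ firstIntervalExpansion N′ h′ L
  firstIntervalExpansion-cong []       N≈ h≈ = h≈ []
  firstIntervalExpansion-cong (z ∷ zs) N≈ h≈ =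
    +-cong (*-cong (h≈ []) (N≈ _)) (firstIntervalExpansion-cong zs N≈ (λ u → h≈ (z ∷ u)))

  firstIntervalExpansion-injective : ∀ N {h h′} L → (∀ u → length u < length L → h u ≈ h′ u)
                                   → firstIntervalExpansion N h L ≈ firstIntervalExpansion N h′ L → h L ≈ h′ L
  firstIntervalExpansion-injective N []       h≈ eq = eq
  firstIntervalExpansion-injective N (z ∷ zs) h≈ eq =
    firstIntervalExpansion-injective N zs (λ u |u|< → h≈ (z ∷ u) (s≤s |u|<))
      (+-cancelʳ _ _ _ (trans (+-comm _ _) (trans eq
        (trans (+-cong (*-cong (sym (h≈ [] (s≤s z≤n))) refl) refl) (+-comm _ _)))))

  firstBlockExpansion-determines : ∀ N (h h′ : 𝒜 → Weight) → N [] ≈ 1#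
    → (∀ x xs → firstBlockExpansion N N (h x) xs ≈ firstBlockExpansion N N (h′ x) xs) → ∀ x xs → h x xs ≈ h′ x xs
  firstBlockExpansion-determines N h h′ N[]≈1 expansions≈ x xs = bounded (suc (length xs)) x xs ≤-refl
    where
    bounded : ∀ n x xs → length xs < n → h x xs ≈ h′ x xs
    bounded (suc n) x xs (s≤s |xs|≤n) = firstBlockExpansion-injective N xs N[]≈1
      (λ u |u|< → bounded n x u (≤-trans |u|< |xs|≤n)) (expansions≈ x xs)

  firstIntervalExpansion-determines : ∀ N (h h′ : 𝒜 → Weight)
    → (∀ x xs → firstIntervalExpansion N (h x) xs ≈ firstIntervalExpansion N (h′ x) xs) → ∀ x xs → h x xs ≈ h′ x xs
  firstIntervalExpansion-determines N h h′ expansions≈ x xs = bounded (suc (length xs)) x xs ≤-refl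
    where
    bounded : ∀ n x xs → length xs < n → h x xs ≈ h′ x xs
    bounded (suc n) x xs (s≤s |xs|≤n) = firstIntervalExpansion-injective N xs
      (λ u |u|< → bounded n x u (≤-trans |u|< |xs|≤n)) (expansions≈ x xs)


module Moments {c ℓ a} (G : CommutativeRing c ℓ) (𝒜 : Set a) (F : List 𝒜 → CommutativeRing.Carrier G) where
  open import Data.List using (List; []; _∷_; _++_)

  open CommutativeRing G
  open import Algebra.Properties.CommutativeSemigroup +-commutativeSemigroup using (x∙yz≈z∙xy)
  open import Algebra.Properties.CommutativeSemigroup *-commutativeSemigroup using (x∙yz≈y∙xz)
  open import Algebra.Solver.Ring.NaturalCoefficients.Default commutativeSemiring
  open import Relation.Binary.Reasoning.Setoid setoid
  open Expansions G 𝒜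

  opened : 𝒜 → Weight
  opened z u = F (z ∷ u)

  closeAll : List Weight → Carrier
  closeAll []       = 1#
  closeAll (h ∷ hs) = h [] * closeAll hs

  joinOpen : (List Weight → Carrier) → 𝒜 → List Weight → Carrier
  joinOpen k z []       = 0#
  joinOpen k z (h ∷ hs) = k ((h ▹ z) ∷ hs) + h [] * joinOpen k z hs

  -- Scanning a word from left to right, each letter either opens a new block or joins one of
  -- the blocks still open, closing every block opened after it.  This enumerates noncrossing
  -- partitions; an open block is stored as the weight it will receive from its remaining letters.
  stackSum : List Weight → List 𝒜 → Carrier
  stackSum hs []       = closeAll hs
  stackSum hs (z ∷ zs) = stackSum (opened z ∷ hs) zs + joinOpen (λ ks → stackSum ks zs) z hs

  freeMoment : List 𝒜 → Carrier
  freeMoment = stackSum []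

  booleanMoment : List 𝒜 → Carrier
  booleanMomentWith : Weight → List 𝒜 → Carrier
  booleanMoment []       = 1#
  booleanMoment (z ∷ zs) = booleanMomentWith (opened z) zs
  booleanMomentWith h []       = h []
  booleanMomentWith h (z ∷ zs) = h [] * booleanMoment (z ∷ zs) + booleanMomentWith (h ▹ z) zs

  joinOpen-cong : ∀ {k k′} z hs → (∀ ks → k ks ≈ k′ ks) → joinOpen k z hs ≈ joinOpen k′ z hs
  joinOpen-cong z []       k≈ = refl
  joinOpen-cong z (h ∷ hs) k≈ = +-cong (k≈ _) (*-cong refl (joinOpen-cong z hs k≈))

  joinOpen-∷ʳ : ∀ k z hs h → joinOpen k z (hs ++ h ∷ [])
                           ≈ joinOpen (λ ks → k (ks ++ h ∷ [])) z hs + closeAll hs * k ((h ▹ z) ∷ [])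
  joinOpen-∷ʳ k z []       h = solve 2 (λ a b → a :+ b :* con 0 := con 0 :+ con 1 :* a) refl _ _
  joinOpen-∷ʳ k z (g ∷ hs) h = trans (+-cong refl (*-cong refl (joinOpen-∷ʳ k z hs h)))
    (solve 5 (λ a b c d e → a :+ b :* (c :+ d :* e) := (a :+ b :* c) :+ (b :* d) :* e) refl _ _ _ _ _)

  closeAll-∷ʳ : ∀ hs h → closeAll (hs ++ h ∷ []) ≈ h [] * closeAll hs
  closeAll-∷ʳ []       h = refl
  closeAll-∷ʳ (g ∷ hs) h = trans (*-cong refl (closeAll-∷ʳ hs h)) (x∙yz≈y∙xz _ _ _)

  firstBlockExpansion-joinOpen : ∀ z hs h L
    → firstBlockExpansion freeMoment (λ J → joinOpen (λ ks → stackSum ks J) z hs) h L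
    ≈ joinOpen (λ ks → firstBlockExpansion freeMoment (stackSum ks) h L) z hs
  firstBlockExpansion-joinOpen z []       h L = firstBlockExpansion-zero freeMoment h L
  firstBlockExpansion-joinOpen z (g ∷ hs) h L =
    trans (firstBlockExpansion-+ freeMoment _ _ h L)
      (+-cong refl (trans (firstBlockExpansion-*ˡ freeMoment _ _ h L)
                          (*-cong refl (firstBlockExpansion-joinOpen z hs h L))))

  -- The block at the bottom of the stack is the one containing the first letter.
  stackSum-∷ʳ : ∀ L hs h → stackSum (hs ++ h ∷ []) L ≈ firstBlockExpansion freeMoment (stackSum hs) h L
  stackSum-∷ʳ []       hs h = closeAll-∷ʳ hs h
  stackSum-∷ʳ (z ∷ zs) hs h = begin
    stackSum (opened z ∷ hs ++ h ∷ []) zs + joinOpen (λ ks → stackSum ks zs) z (hs ++ h ∷ [])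
      ≈⟨ +-cong (stackSum-∷ʳ zs (opened z ∷ hs) h) (joinOpen-∷ʳ _ z hs h) ⟩
    T (stackSum (opened z ∷ hs)) h zs
      + (joinOpen (λ ks → stackSum (ks ++ h ∷ []) zs) z hs + closeAll hs * stackSum ((h ▹ z) ∷ []) zs)
      ≈⟨ +-cong refl (+-cong (joinOpen-cong z hs (λ ks → stackSum-∷ʳ zs ks h))
                              (*-cong refl (stackSum-∷ʳ zs [] (h ▹ z)))) ⟩
    T (stackSum (opened z ∷ hs)) h zs
      + (joinOpen (λ ks → T (stackSum ks) h zs) z hs + closeAll hs * T freeMoment (h ▹ z) zs)
      ≈⟨ x∙yz≈z∙xy _ _ _ ⟩
    closeAll hs * T freeMoment (h ▹ z) zs
      + (T (stackSum (opened z ∷ hs)) h zs + joinOpen (λ ks → T (stackSum ks) h zs) z hs)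
      ≈⟨ +-cong refl (sym (trans (firstBlockExpansion-+ freeMoment _ _ h zs)
                                  (+-cong refl (firstBlockExpansion-joinOpen z hs h zs)))) ⟩
    closeAll hs * T freeMoment (h ▹ z) zs + T (λ J → stackSum hs (z ∷ J)) h zs ∎
    where
    T : Weight → Weight → List 𝒜 → Carrier
    T = firstBlockExpansion freeMoment

  freeMoment-firstBlock : ∀ x xs → freeMoment (x ∷ xs) ≈ firstBlockExpansion freeMoment freeMoment (opened x) xs
  freeMoment-firstBlock x xs = trans (+-identityʳ _) (stackSum-∷ʳ xs [] (opened x))

  booleanMomentWith-firstInterval : ∀ h L → booleanMomentWith h L ≈ firstIntervalExpansion booleanMoment h L
  booleanMomentWith-firstInterval h []       = refl
  booleanMomentWith-firstInterval h (z ∷ zs) = +-cong refl (booleanMomentWith-firstInterval (h ▹ z) zs)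


module PartitionInsertion {c ℓ a m} (R : CommutativeRing c ℓ) (M : Monoid a m) where

  open import Data.Nat using (ℕ; suc; _<_; _≤_)
  open import Data.Nat.Properties using (≤-refl; <⇒≤; ≤-trans; n≤1+n)
  open import Data.Product using (_×_; _,_; proj₁)
  open import Data.List using (List; []; _∷_; _++_; map)
  open import Data.List.Properties using (map-∘)
  open import Data.List.NonEmpty using (List⁺; _∷_; [_]; toList)
  import Data.List.NonEmpty as List⁺
  open import Data.List.Relation.Unary.All as All using (All; []; _∷_)
  open import Data.List.Relation.Unary.All.Properties using (map⁺; concat⁺)
  open import Data.List.Relation.Unary.AllPairs using (AllPairs; []; _∷_)
  open import Data.List.Membership.Propositional using (_∈_)
  open import Data.List.Membership.Propositional.Properties using (∈-++⁺ʳ)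
  open import Data.List.Relation.Unary.Any using (here; there)
  open import Relation.Binary.PropositionalEquality using (_≡_; refl; sym; cong; subst; module ≡-Reasoning)
  open import Function using (_∘_)
  open Setup R M using (Pos; Partition; idx; insertEach; partitions)
  open ListLemmas using (All-replace; AllPairs-replace)

  Block : Set a
  Block = List⁺ Pos

  _◃_ : Pos → Block → Block
  y ◃ B = y ∷ toList B

  Split : Set a
  Split = Partition × Block × Partition

  unsplit : Split → Partition
  unsplit (pre , B , post) = pre ++ B ∷ post

  plug : Pos → Split → Partition
  plug y (pre , B , post) = pre ++ (y ◃ B) ∷ post

  consPrefix : Block → Split → Split
  consPrefix C (pre , B , post) = (C ∷ pre , B , post)

  splits : Partition → List Split
  splits []       = []
  splits (B ∷ Bs) = ([] , B , Bs) ∷ map (consPrefix B) (splits Bs)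

  insertEach≡plug-splits : ∀ y q → insertEach y q ≡ map (plug y) (splits q)
  insertEach≡plug-splits y []       = refl
  insertEach≡plug-splits y (B ∷ Bs) = cong (((y ◃ B) ∷ Bs) ∷_) (begin
    map (B ∷_) (insertEach y Bs)                   ≡⟨ cong (map (B ∷_)) (insertEach≡plug-splits y Bs) ⟩
    map (B ∷_) (map (plug y) (splits Bs))          ≡⟨ sym (map-∘ (splits Bs)) ⟩
    map (plug y ∘ consPrefix B) (splits Bs)        ≡⟨ map-∘ (splits Bs) ⟩
    map (plug y) (map (consPrefix B) (splits Bs))  ∎)
    where open ≡-Reasoning

  unsplit-splits : ∀ q → All (λ s → unsplit s ≡ q) (splits q)
  unsplit-splits []       = []
  unsplit-splits (B ∷ Bs) = refl ∷ map⁺ (All.map (cong (B ∷_)) (unsplit-splits Bs))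

  lastOf : ℕ → List ℕ → ℕ
  lastOf x []       = x
  lastOf x (y ∷ ys) = lastOf y ys

  lastOf-∈ : ∀ x ys → lastOf x ys ∈ x ∷ ys
  lastOf-∈ x []       = here refl
  lastOf-∈ x (y ∷ ys) = there (lastOf-∈ y ys)

  lastIndex : Block → ℕ
  lastIndex B = lastOf (proj₁ (List⁺.head B)) (map proj₁ (List⁺.tail B))

  lastIndex-∈ : ∀ B → lastIndex B ∈ idx B
  lastIndex-∈ B = lastOf-∈ _ _

  Above : ℕ → Block → Set
  Above n B = All (n <_) (idx B)

  EndsWithMax : Block → Set
  EndsWithMax B = All (_≤ lastIndex B) (idx B)

  _<ˡ_ : Block → Block → Set
  B <ˡ C = lastIndex B < lastIndex C

  WellOrdered : Partition → Set a
  WellOrdered p = All EndsWithMax p × AllPairs _<ˡ_ p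

  IncreasingPositions : List Pos → Set a
  IncreasingPositions = AllPairs (λ y z → proj₁ y < proj₁ z)

  data Consecutive : ℕ → List Pos → Set a where
    []  : ∀ {k} → Consecutive k []
    _∷_ : ∀ {k y ys} → proj₁ y ≡ k → Consecutive (suc k) ys → Consecutive k (y ∷ ys)

  Consecutive-≥ : ∀ {k L} → Consecutive k L → All (λ w → k ≤ proj₁ w) L
  Consecutive-≥ []         = []
  Consecutive-≥ (refl ∷ c) = ≤-refl ∷ All.map (≤-trans (n≤1+n _)) (Consecutive-≥ c)

  Consecutive⇒IncreasingPositions : ∀ {k L} → Consecutive k L → IncreasingPositions L
  Consecutive⇒IncreasingPositions []         = []
  Consecutive⇒IncreasingPositions (refl ∷ c) = Consecutive-≥ c ∷ Consecutive⇒IncreasingPositions c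

  All-partitions-∷ : ∀ {P Q : Partition → Set a} y ys → All Q (partitions ys)
                   → (∀ {q} → Q q → P ([ y ] ∷ q)) → (∀ s → Q (unsplit s) → P (plug y s))
                   → All P (partitions (y ∷ ys))
  All-partitions-∷ {P} {Q} y ys Qs single plugged = concat⁺ (map⁺ (All.map (λ {q} Qq →
    single Qq ∷ subst (All P) (sym (insertEach≡plug-splits y q))
                      (map⁺ (All.map (λ {s} e → plugged s (subst Q (sym e) Qq)) (unsplit-splits q)))) Qs))

  partitions-above : ∀ n L → All (λ z → n < proj₁ z) L → All (All (Above n)) (partitions L)
  partitions-above n []       []           = [] ∷ []
  partitions-above n (y ∷ ys) (n<y ∷ n<ys) =
    All-partitions-∷ y ys (partitions-above n ys n<ys) ((n<y ∷ []) ∷_)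
      (λ (pre , B , post) above → All-replace pre above (n<y ∷ All.lookup above (∈-++⁺ʳ pre (here refl))))

  partitions-wellOrdered : ∀ L → IncreasingPositions L → All WellOrdered (partitions L)
  partitions-wellOrdered []       []         = ([] , []) ∷ []
  partitions-wellOrdered (y ∷ ys) (y< ∷ inc) =
    All-partitions-∷ y ys (All.zipWith (λ x → x) (partitions-wellOrdered ys inc , partitions-above (proj₁ y) ys y<))
      (λ ((maxs , sorted) , above) →
        (≤-refl ∷ []) ∷ maxs , All.map (λ {C} aboveC → All.lookup aboveC (lastIndex-∈ C)) above ∷ sorted)
      (λ (pre , B , post) ((maxs , sorted) , above) →
        let B∈ = ∈-++⁺ʳ pre (here refl) in
        All-replace pre maxs (<⇒≤ (All.lookup (All.lookup above B∈) (lastIndex-∈ B)) ∷ All.lookup maxs B∈)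
        , AllPairs-replace pre (λ x → x) (λ x → x) sorted)


module Crossing {c ℓ a m} (R : CommutativeRing c ℓ) (M : Monoid a m) where

  open import Algebra.Bundles using (CommutativeMonoid)
  import Algebra.Properties.CommutativeSemigroup as CommutativeSemigroupProperties
  open import Data.Bool using (Bool; true; false; _∧_; _∨_; not)
  open import Data.Bool.Properties using (∧-assoc; ∧-zeroʳ; ∧-commutativeMonoid)
  open import Data.Bool.ListAction using (any; all)
  open import Data.Nat using (ℕ; _<_; _<ᵇ_)
  open import Data.Nat.Properties using (<⇒≤; ≤-<-trans)
  open import Data.Product using (_×_; _,_; proj₁)
  open import Data.List using (List; []; _∷_; _++_; map; length; replicate)
  open import Data.List.Properties using (++-assoc; ++-identityʳ)
  open import Data.List.NonEmpty using ([_])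
  open import Data.List.Relation.Unary.All as All using (All; []; _∷_)
  open import Data.List.Relation.Unary.All.Properties using (++⁺; ++⁻ˡ; ++⁻ʳ)
  open import Data.List.Relation.Unary.Any using (here)
  open import Data.List.Membership.Propositional.Properties using (∈-++⁺ʳ)
  open import Relation.Binary.PropositionalEquality using (_≡_; refl; sym; trans; cong; cong₂; module ≡-Reasoning)
  open Setup R M using (Pos; Partition; idx; crosses; isNonCrossing)
  open ListLemmas
  open PartitionInsertion R M

  module ∧ = CommutativeSemigroupProperties (CommutativeMonoid.commutativeSemigroup ∧-commutativeMonoid)

  private
    >⇒>ᵇ≡false : ∀ {n x} → n < x → (x <ᵇ n) ≡ false
    >⇒>ᵇ≡false n<x = ≤⇒>ᵇ≡false (<⇒≤ n<x)

    any-const-false : ∀ {b} {A : Set b} {p : A → Bool} xs → (∀ x → p x ≡ false) → any p xs ≡ false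
    any-const-false xs p≡false = any-false (All.universal p≡false xs)

    false-∨ : ∀ {x} y → x ≡ false → x ∨ y ≡ y
    false-∨ y refl = refl

  straddles : Block → Block → Bool
  straddles C B = any (λ c → any (λ b → any (λ c′ → (c <ᵇ b) ∧ (b <ᵇ c′)) (idx C)) (idx B)) (idx C)

  someBelow : Block → Block → Bool
  someBelow C B = any (λ c → any (λ b → c <ᵇ b) (idx B)) (idx C)

  isOuterIn : Partition → Block → Bool
  isOuterIn os B = all (λ C → not (straddles C B)) os

  crosses-singletonˡ : ∀ y W → crosses [ y ] W ≡ false
  crosses-singletonˡ y W =
    any-const-false (proj₁ y ∷ []) λ x → any-const-false (idx W) λ y′ → any-const-false (proj₁ y ∷ []) λ z →
    any-const-false (idx W) λ t → trans (sym (∧-assoc (x <ᵇ y′) (y′ <ᵇ x) (x <ᵇ t)))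
                                        (cong (_∧ (x <ᵇ t)) (<ᵇ-asym x y′))

  crosses-singletonʳ : ∀ y W → crosses W [ y ] ≡ false
  crosses-singletonʳ y W =
    any-const-false (idx W) λ x → any-const-false (proj₁ y ∷ []) λ y′ → any-const-false (idx W) λ z →
    any-const-false (proj₁ y ∷ []) λ t → trans (cong (λ u → (x <ᵇ y′) ∧ u) (<ᵇ-asym y′ z)) (∧-zeroʳ _)

  straddles-singletonˡ : ∀ y C → straddles [ y ] C ≡ false
  straddles-singletonˡ y C =
    any-const-false (proj₁ y ∷ []) λ x → any-const-false (idx C) λ b → any-const-false (proj₁ y ∷ []) λ _ → <ᵇ-asym x b

  -- y lies below every index of W (resp. C), so it can only be the smallest of the witnesses.
  module _ (y : Pos) (B : Block) where
    private
      n = proj₁ y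

    crosses-◃ˡ : ∀ W → Above n W → crosses (y ◃ B) W ≡ straddles W B ∨ crosses B W
    crosses-◃ˡ W aboveW = cong₂ _∨_
      (any-cong (All.map (λ {y′} n<y′ → from-y y′ n<y′) aboveW))
      (any-cong (All.tabulate {xs = idx B} λ {x} _ → any-cong (All.map (λ {y′} n<y′ → from-B x y′ n<y′) aboveW)))
      where
      from-y : ∀ y′ → n < y′
        → any (λ t → (n <ᵇ y′) ∧ ((y′ <ᵇ n) ∧ (n <ᵇ t))) (idx W)
          ∨ any (λ z → any (λ t → (n <ᵇ y′) ∧ ((y′ <ᵇ z) ∧ (z <ᵇ t))) (idx W)) (idx B)
        ≡ any (λ z → any (λ t → (y′ <ᵇ z) ∧ (z <ᵇ t)) (idx W)) (idx B)
      from-y y′ n<y′ rewrite <⇒<ᵇ≡true n<y′ | >⇒>ᵇ≡false n<y′ = false-∨ _ (any-const-false (idx W) λ _ → refl)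
      from-B : ∀ x y′ → n < y′
        → any (λ t → (x <ᵇ y′) ∧ ((y′ <ᵇ n) ∧ (n <ᵇ t))) (idx W)
          ∨ any (λ z → any (λ t → (x <ᵇ y′) ∧ ((y′ <ᵇ z) ∧ (z <ᵇ t))) (idx W)) (idx B)
        ≡ any (λ z → any (λ t → (x <ᵇ y′) ∧ ((y′ <ᵇ z) ∧ (z <ᵇ t))) (idx W)) (idx B)
      from-B x y′ n<y′ rewrite >⇒>ᵇ≡false n<y′ = false-∨ _ (any-const-false (idx W) λ _ → ∧-zeroʳ (x <ᵇ y′))

    crosses-◃ʳ : ∀ W → Above n W → crosses W (y ◃ B) ≡ crosses W B
    crosses-◃ʳ W aboveW = any-cong (All.map (λ {x} n<x → cong₂ _∨_ (at-y x n<x)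
        (any-cong (All.tabulate {xs = idx B} λ {y′} _ → any-cong (All.map (λ {z} n<z → skip-y x y′ z n<z) aboveW))))
        aboveW)
      where
      at-y : ∀ x → n < x → any (λ z → any (λ t → (x <ᵇ n) ∧ ((n <ᵇ z) ∧ (z <ᵇ t))) (n ∷ idx B)) (idx W) ≡ false
      at-y x n<x rewrite >⇒>ᵇ≡false n<x = any-const-false (idx W) λ _ → any-const-false (n ∷ idx B) λ _ → refl
      skip-y : ∀ x y′ z → n < z
        → any (λ t → (x <ᵇ y′) ∧ ((y′ <ᵇ z) ∧ (z <ᵇ t))) (n ∷ idx B) ≡ any (λ t → (x <ᵇ y′) ∧ ((y′ <ᵇ z) ∧ (z <ᵇ t))) (idx B)
      skip-y x y′ z n<z rewrite >⇒>ᵇ≡false n<z | ∧-zeroʳ (y′ <ᵇ z) | ∧-zeroʳ (x <ᵇ y′) = refl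

    straddles-◃ʳ : ∀ C → Above n C → straddles C (y ◃ B) ≡ straddles C B
    straddles-◃ʳ C aboveC = any-cong (All.map (λ {c} n<c → skip-y c n<c) aboveC)
      where
      skip-y : ∀ c → n < c → any (λ b → any (λ c′ → (c <ᵇ b) ∧ (b <ᵇ c′)) (idx C)) (n ∷ idx B)
                           ≡ any (λ b → any (λ c′ → (c <ᵇ b) ∧ (b <ᵇ c′)) (idx C)) (idx B)
      skip-y c n<c rewrite >⇒>ᵇ≡false n<c = false-∨ _ (any-const-false (idx C) λ _ → refl)

    straddles-◃ˡ : ∀ C → Above n C → straddles (y ◃ B) C ≡ someBelow C B ∨ straddles B C
    straddles-◃ˡ C aboveC = cong₂ _∨_
      (any-cong (All.map (λ {c} n<c → from-y c n<c) aboveC))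
      (any-cong (All.tabulate {xs = idx B} λ {x} _ → any-cong (All.map (λ {c} n<c → from-B x c n<c) aboveC)))
      where
      from-y : ∀ c → n < c → ((n <ᵇ c) ∧ (c <ᵇ n)) ∨ any (λ x′ → (n <ᵇ c) ∧ (c <ᵇ x′)) (idx B) ≡ any (λ b → c <ᵇ b) (idx B)
      from-y c n<c rewrite <⇒<ᵇ≡true n<c | >⇒>ᵇ≡false n<c = refl
      from-B : ∀ x c → n < c → ((x <ᵇ c) ∧ (c <ᵇ n)) ∨ any (λ x′ → (x <ᵇ c) ∧ (c <ᵇ x′)) (idx B)
                             ≡ any (λ x′ → (x <ᵇ c) ∧ (c <ᵇ x′)) (idx B)
      from-B x c n<c rewrite >⇒>ᵇ≡false n<c | ∧-zeroʳ (x <ᵇ c) = refl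

  private
    not-∨ : ∀ x y → not (x ∨ y) ≡ not x ∧ not y
    not-∨ true  y = refl
    not-∨ false y = refl

    all-∧ : ∀ {A : Set a} (f g : A → Bool) xs → all (λ x → f x ∧ g x) xs ≡ all f xs ∧ all g xs
    all-∧ f g []       = refl
    all-∧ f g (x ∷ xs) rewrite all-∧ f g xs = ∧.interchange (f x) (g x) (all f xs) (all g xs)

    ∧-rearrange : ∀ F p s c q n o → F ∧ ((p ∧ ((s ∧ c) ∧ q)) ∧ (n ∧ o)) ≡ (F ∧ ((p ∧ (c ∧ q)) ∧ n)) ∧ (s ∧ o)
    ∧-rearrange = solve 7 (λ F p s c q n o → F :* ((p :* ((s :* c) :* q)) :* (n :* o))
                                          := (F :* ((p :* (c :* q)) :* n)) :* (s :* o)) refl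
      where open import Data.Bool.Solver using (module ∨-∧-Solver)
            open ∨-∧-Solver

  isNonCrossing-∷ : ∀ B q → isNonCrossing (B ∷ q)
                  ≡ all (λ W → not (crosses B W)) q ∧ (all (λ W → not (crosses W B)) q ∧ isNonCrossing q)
  isNonCrossing-∷ B q = trans (all-++ noCross (map (B ,_) q) _)
    (cong₂ _∧_ (all-map noCross (B ,_) q) (trans (all-++ noCross (map (_, B) q) _) (cong₂ _∧_ (all-map noCross (_, B) q) refl)))
    where
    noCross : Block × Block → Bool
    noCross (V , W) = not (crosses V W)

  isNonCrossing-singleton : ∀ y q → isNonCrossing ([ y ] ∷ q) ≡ isNonCrossing q
  isNonCrossing-singleton y q
    rewrite isNonCrossing-∷ [ y ] q
          | all-true (All.universal {P = λ W → not (crosses [ y ] W) ≡ true} (λ W → cong not (crosses-singletonˡ y W)) q)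
          | all-true (All.universal {P = λ W → not (crosses W [ y ]) ≡ true} (λ W → cong not (crosses-singletonʳ y W)) q)
          = refl

  isNonCrossing-plug : ∀ y B pre post → All (Above (proj₁ y)) (pre ++ B ∷ post)
    → isNonCrossing (pre ++ (y ◃ B) ∷ post) ≡ isNonCrossing (pre ++ B ∷ post) ∧ isOuterIn (pre ++ post) B
  isNonCrossing-plug y B [] post (_ ∷ abovePost) = begin
    isNonCrossing ((y ◃ B) ∷ post)
      ≡⟨ isNonCrossing-∷ (y ◃ B) post ⟩
    all (λ W → not (crosses (y ◃ B) W)) post ∧ (all (λ W → not (crosses W (y ◃ B))) post ∧ isNonCrossing post)
      ≡⟨ cong₂ (λ u v → u ∧ (v ∧ isNonCrossing post))
           (trans (all-cong (All.map (λ {W} aboveW → not-crosses-◃ˡ W aboveW) abovePost))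
                  (all-∧ (λ W → not (straddles W B)) (λ W → not (crosses B W)) post))
           (all-cong (All.map (λ {W} aboveW → cong not (crosses-◃ʳ y B W aboveW)) abovePost)) ⟩
    (isOuterIn post B ∧ all (λ W → not (crosses B W)) post) ∧ (all (λ W → not (crosses W B)) post ∧ isNonCrossing post)
      ≡⟨ ∧.xy∙z≈yz∙x (isOuterIn post B) _ _ ⟩
    (all (λ W → not (crosses B W)) post ∧ (all (λ W → not (crosses W B)) post ∧ isNonCrossing post)) ∧ isOuterIn post B
      ≡⟨ cong (_∧ isOuterIn post B) (sym (isNonCrossing-∷ B post)) ⟩
    isNonCrossing (B ∷ post) ∧ isOuterIn post B ∎
    where
    open ≡-Reasoning
    not-crosses-◃ˡ : ∀ W → Above (proj₁ y) W → not (crosses (y ◃ B) W) ≡ not (straddles W B) ∧ not (crosses B W)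
    not-crosses-◃ˡ W aboveW = trans (cong not (crosses-◃ˡ y B W aboveW)) (not-∨ (straddles W B) (crosses B W))
  isNonCrossing-plug y B (D ∷ pre) post (aboveD ∷ above) = begin
    isNonCrossing (D ∷ pre ++ (y ◃ B) ∷ post)
      ≡⟨ isNonCrossing-∷ D (pre ++ (y ◃ B) ∷ post) ⟩
    all f (pre ++ (y ◃ B) ∷ post) ∧ (all g (pre ++ (y ◃ B) ∷ post) ∧ isNonCrossing (pre ++ (y ◃ B) ∷ post))
      ≡⟨ cong₂ (λ u v → u ∧ (v ∧ isNonCrossing (pre ++ (y ◃ B) ∷ post)))
           (trans (all-++ f pre _) (cong (λ u → all f pre ∧ (u ∧ all f post)) (cong not (crosses-◃ʳ y B D aboveD))))
           (trans (all-++ g pre _) (cong (λ u → all g pre ∧ (u ∧ all g post))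
                                         (trans (cong not (crosses-◃ˡ y B D aboveD)) (not-∨ (straddles D B) _)))) ⟩
    (all f pre ∧ (f B ∧ all f post)) ∧ ((all g pre ∧ ((not (straddles D B) ∧ g B) ∧ all g post))
                                         ∧ isNonCrossing (pre ++ (y ◃ B) ∷ post))
      ≡⟨ cong (λ u → (all f pre ∧ (f B ∧ all f post)) ∧ ((all g pre ∧ ((not (straddles D B) ∧ g B) ∧ all g post)) ∧ u))
              (isNonCrossing-plug y B pre post above) ⟩
    (all f pre ∧ (f B ∧ all f post)) ∧ ((all g pre ∧ ((not (straddles D B) ∧ g B) ∧ all g post))
                                         ∧ (isNonCrossing (pre ++ B ∷ post) ∧ isOuterIn (pre ++ post) B))
      ≡⟨ ∧-rearrange (all f pre ∧ (f B ∧ all f post)) (all g pre) (not (straddles D B)) (g B) (all g post)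
                     (isNonCrossing (pre ++ B ∷ post)) (isOuterIn (pre ++ post) B) ⟩
    ((all f pre ∧ (f B ∧ all f post)) ∧ ((all g pre ∧ (g B ∧ all g post)) ∧ isNonCrossing (pre ++ B ∷ post)))
      ∧ (not (straddles D B) ∧ isOuterIn (pre ++ post) B)
      ≡⟨ cong (_∧ (not (straddles D B) ∧ isOuterIn (pre ++ post) B))
              (sym (trans (isNonCrossing-∷ D (pre ++ B ∷ post))
                          (cong₂ (λ u v → u ∧ (v ∧ isNonCrossing (pre ++ B ∷ post))) (all-++ f pre _) (all-++ g pre _)))) ⟩
    isNonCrossing (D ∷ pre ++ B ∷ post) ∧ isOuterIn (D ∷ pre ++ post) B ∎
    where open ≡-Reasoning
          f g : Block → Bool
          f W = not (crosses D W)
          g W = not (crosses W D)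

  -- P lists the blocks preceding q; a block is outer when no other block straddles it.
  outerFlagsAfter : Partition → Partition → List Bool
  outerFlagsAfter P []         = []
  outerFlagsAfter P (B ∷ post) = isOuterIn (P ++ post) B ∷ outerFlagsAfter (P ++ B ∷ []) post

  outerFlags : Partition → List Bool
  outerFlags = outerFlagsAfter []

  outerFlagsAfter-singleton : ∀ y P q → outerFlagsAfter ([ y ] ∷ P) q ≡ outerFlagsAfter P q
  outerFlagsAfter-singleton y P []      = refl
  outerFlagsAfter-singleton y P (C ∷ q) rewrite straddles-singletonˡ y C =
    cong (isOuterIn (P ++ q) C ∷_) (outerFlagsAfter-singleton y (P ++ C ∷ []) q)

  isOuterIn-singleton : ∀ y q → All (Above (proj₁ y)) q → isOuterIn q [ y ] ≡ true
  isOuterIn-singleton y q above = all-true (All.map (λ {C} aboveC →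
    cong not (any-false (All.map (λ {c} y<c → not-between C c y<c) aboveC))) above)
    where
    not-between : ∀ C c → proj₁ y < c → any (λ c′ → (c <ᵇ proj₁ y) ∧ (proj₁ y <ᵇ c′)) (idx C) ∨ false ≡ false
    not-between C c y<c rewrite >⇒>ᵇ≡false y<c | any-const-false {p = λ (_ : ℕ) → false} (idx C) (λ _ → refl) = refl

  outerFlags-singleton : ∀ y q → All (Above (proj₁ y)) q → outerFlags ([ y ] ∷ q) ≡ true ∷ outerFlags q
  outerFlags-singleton y q above = cong₂ _∷_ (isOuterIn-singleton y q above) (outerFlagsAfter-singleton y [] q)

  isOuterIn-◃ : ∀ y B os → All (Above (proj₁ y)) os → isOuterIn os (y ◃ B) ≡ isOuterIn os B
  isOuterIn-◃ y B os above = all-cong (All.map (λ {C} aboveC → cong not (straddles-◃ʳ y B C aboveC)) above)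

  module _ (y : Pos) (B : Block) where

    straddles-◃-earlier : ∀ C → Above (proj₁ y) C → C <ˡ B → straddles (y ◃ B) C ≡ true
    straddles-◃-earlier C aboveC C<B rewrite straddles-◃ˡ y B C aboveC
      | any-true {p = λ c → any (λ b → c <ᵇ b) (idx B)} (lastIndex-∈ C)
          (any-true {p = λ b → lastIndex C <ᵇ b} (lastIndex-∈ B) (<⇒<ᵇ≡true C<B)) = refl

    someBelow-later : ∀ C → EndsWithMax B → B <ˡ C → straddles C B ≡ false → someBelow C B ≡ false
    someBelow-later C maxB B<C unstraddled with someBelow C B in below
    ... | false = refl
    ... | true with any-true⁻ (idx C) below
    ...   | c , c∈ , c<B with any-true⁻ (idx B) c<B
    ...     | b , b∈ , c<b with trans (sym unstraddled)
          (any-true c∈ (any-true b∈ (any-true {p = λ c′ → (c <ᵇ b) ∧ (b <ᵇ c′)} (lastIndex-∈ C)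
            (trans (cong (_∧ (b <ᵇ lastIndex C)) c<b) (<⇒<ᵇ≡true (≤-<-trans (All.lookup maxB b∈) B<C))))))
    ...       | ()

    straddles-◃-later : ∀ C → Above (proj₁ y) C → EndsWithMax B → B <ˡ C → straddles C B ≡ false
                      → straddles (y ◃ B) C ≡ straddles B C
    straddles-◃-later C aboveC maxB B<C unstraddled
      rewrite straddles-◃ˡ y B C aboveC | someBelow-later C maxB B<C unstraddled = refl

  outerFlagsAfter-straddled : ∀ X post P xs → All (λ C → straddles X C ≡ true) xs
    → outerFlagsAfter P (xs ++ X ∷ post) ≡ replicate (length xs) false ++ outerFlagsAfter (P ++ xs) (X ∷ post)
  outerFlagsAfter-straddled X post P []       []            rewrite ++-identityʳ P = refl
  outerFlagsAfter-straddled X post P (C ∷ xs) (X⊐C ∷ X⊐xs) = cong₂ _∷_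
    (all-false {p = λ D → not (straddles D C)} (∈-++⁺ʳ P (∈-++⁺ʳ xs (here refl))) (cong not X⊐C))
    (trans (outerFlagsAfter-straddled X post (P ++ C ∷ []) xs X⊐xs)
           (cong (λ Q → replicate (length xs) false ++ outerFlagsAfter Q (X ∷ post)) (++-assoc P (C ∷ []) xs)))

  outerFlagsAfter-replace : ∀ X X′ pre mid post → All (λ C → straddles X C ≡ straddles X′ C) post
    → outerFlagsAfter (pre ++ X ∷ mid) post ≡ outerFlagsAfter (pre ++ X′ ∷ mid) post
  outerFlagsAfter-replace X X′ pre mid []         []       = refl
  outerFlagsAfter-replace X X′ pre mid (C ∷ post) (e ∷ es) = cong₂ _∷_ outer rest
    where
    outer : isOuterIn ((pre ++ X ∷ mid) ++ post) C ≡ isOuterIn ((pre ++ X′ ∷ mid) ++ post) C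
    outer rewrite ++-assoc pre (X ∷ mid) post | ++-assoc pre (X′ ∷ mid) post
                | all-++ (λ D → not (straddles D C)) pre (X ∷ mid ++ post)
                | all-++ (λ D → not (straddles D C)) pre (X′ ∷ mid ++ post) | e = refl
    rest : outerFlagsAfter ((pre ++ X ∷ mid) ++ C ∷ []) post ≡ outerFlagsAfter ((pre ++ X′ ∷ mid) ++ C ∷ []) post
    rest rewrite ++-assoc pre (X ∷ mid) (C ∷ []) | ++-assoc pre (X′ ∷ mid) (C ∷ []) =
      outerFlagsAfter-replace X X′ pre (mid ++ C ∷ []) post es

  -- When y joins an outer block B, the blocks ending before B become nested in y ◃ B.
  outerFlags-plug : ∀ y B pre post → All (Above (proj₁ y)) (pre ++ B ∷ post) → EndsWithMax B
    → All (_<ˡ B) pre → All (B <ˡ_) post → isOuterIn (pre ++ post) B ≡ true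
    → outerFlags (pre ++ (y ◃ B) ∷ post) ≡ replicate (length pre) false ++ true ∷ outerFlagsAfter (pre ++ B ∷ []) post
  outerFlags-plug y B pre post above maxB pre<B B<post outerB =
    trans (outerFlagsAfter-straddled (y ◃ B) post [] pre
             (All.zipWith (λ {C} (C<B , aboveC) → straddles-◃-earlier y B C aboveC C<B) (pre<B , abovePre)))
          (cong (replicate (length pre) false ++_) (cong₂ _∷_
             (trans (isOuterIn-◃ y B (pre ++ post) (++⁺ abovePre abovePost)) outerB)
             (outerFlagsAfter-replace (y ◃ B) B pre [] post
                (All.zipWith (λ {C} ((B<C , aboveC) , unstraddled) → straddles-◃-later y B C aboveC maxB B<C unstraddled)
                   (All.zipWith (λ x → x) (B<post , abovePost) , postUnstraddling)))))
    where
    abovePre  = ++⁻ˡ pre above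
    abovePost = All.tail (++⁻ʳ pre above)
    postUnstraddling : All (λ C → straddles C B ≡ false) post
    postUnstraddling = All.tabulate λ C∈ →
      not-injective (all-true⁻ {p = λ C → not (straddles C B)} (pre ++ post) outerB (∈-++⁺ʳ pre C∈))
      where
      not-injective : ∀ {x} → not x ≡ true → x ≡ false
      not-injective {false} _ = refl


module PartitionWeights {c ℓ c′ ℓ′ a m} (R : CommutativeRing c ℓ) (M : Monoid a m)
  (G : CommutativeRing c′ ℓ′) (F : List (Monoid.Carrier M) → CommutativeRing.Carrier G) where
  open import Data.List using (List; []; _∷_; _++_; map; foldr)

  open import Data.Bool using (Bool; true; false; if_then_else_)
  open import Data.Product using (proj₂)
  open import Data.List.NonEmpty using (toList)
  open Setup R M using (Partition; filterB)
  open PartitionInsertion R M using (Block)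
  open CommutativeRing G
  open RingSums G

  letters : Block → List (Monoid.Carrier M)
  letters B = map proj₂ (toList B)

  weight : Partition → Carrier
  weight = foldr (λ B w → F (letters B) * w) 1#

  weight-∷ʳ : ∀ p B → weight (p ++ B ∷ []) ≈ weight p * F (letters B)
  weight-∷ʳ []      B = trans (*-identityʳ _) (sym (*-identityˡ _))
  weight-∷ʳ (C ∷ p) B = trans (*-cong refl (weight-∷ʳ p B)) (sym (*-assoc _ _ _))

  sum-filterB : ∀ {A : Set a} (p : A → Bool) (f : A → Carrier) xs
              → sum (map f (filterB p xs)) ≈ sum (map (λ x → if p x then f x else 0#) xs)
  sum-filterB p f []       = refl
  sum-filterB p f (x ∷ xs) with p x
  ... | true  = +-cong refl (sum-filterB p f xs)
  ... | false = trans (sum-filterB p f xs) (sym (+-identityˡ _))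


module NoncrossingSums {c ℓ c′ ℓ′ a m} (R : CommutativeRing c ℓ) (M : Monoid a m)
  (G : CommutativeRing c′ ℓ′) (F : List (Monoid.Carrier M) → CommutativeRing.Carrier G) where
  open import Data.List using (List; []; _∷_; _++_; map; concatMap; length; replicate)

  open import Data.Bool using (Bool; true; false; if_then_else_)
  open import Data.Product using (_,_; proj₁; proj₂)
  open import Data.List.NonEmpty using ([_])
  open import Data.List.Properties using (++-assoc; map-∘; map-cong)
  open import Data.List.Relation.Unary.All as All using (All)
  open import Data.List.Relation.Unary.AllPairs using (_∷_)
  open import Data.List.Relation.Unary.Any using (here)
  open import Data.List.Membership.Propositional.Properties using (∈-++⁺ʳ)
  import Relation.Binary.PropositionalEquality as ≡
  open Setup R M using (Pos; Partition; partitions; filterB; isNonCrossing; insertEach)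
  open ListLemmas using (AllPairs-split)
  open PartitionInsertion R M
  open Crossing R M

  open CommutativeRing G
  open import Algebra.Properties.CommutativeSemigroup *-commutativeSemigroup using (x∙yz≈y∙xz)
  open import Algebra.Solver.Ring.NaturalCoefficients.Default commutativeSemiring
  open import Relation.Binary.Reasoning.Setoid setoid
  open RingSums G
  open Expansions G (Monoid.Carrier M)
  open Moments G (Monoid.Carrier M) F
  open PartitionWeights R M G F

  -- The stack machine of `stackSum` run on a list of complete blocks: each block either stays a
  -- block of its own or supplies the remaining letters of one of the open blocks.
  stackSumBlocks : List Weight → List Block → Carrier
  attachBlock : List Weight → Block → List Block → Carrier
  stackSumBlocks hs []      = closeAll hs
  stackSumBlocks hs (B ∷ O) = F (letters B) * stackSumBlocks hs O + attachBlock hs B O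
  attachBlock []       B O = 0#
  attachBlock (h ∷ hs) B O = h (letters B) * stackSumBlocks hs O + h [] * attachBlock hs B O

  joinOuter : (List Block → Carrier) → Pos → List Block → Carrier
  joinOuter k y []      = 0#
  joinOuter k y (B ∷ O) = k ((y ◃ B) ∷ O) + F (letters B) * joinOuter k y O

  -- How a continuation on the outer blocks changes when a new first position y is added.
  prepend : Pos → (List Block → Carrier) → List Block → Carrier
  prepend y k O = k ([ y ] ∷ O) + joinOuter k y O

  private
    attachTop : Weight → List Weight → List Block → Carrier
    attachTop g hs []      = 0#
    attachTop g hs (B ∷ O) = g (letters B) * stackSumBlocks hs O + F (letters B) * attachTop g hs O

    attachJoined : List Weight → Pos → List Block → Carrier
    attachJoined hs y []      = 0#
    attachJoined hs y (B ∷ O) = attachBlock hs (y ◃ B) O + F (letters B) * attachJoined hs y O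

    stackSumBlocks-∷ : ∀ g hs O → stackSumBlocks (g ∷ hs) O ≈ g [] * stackSumBlocks hs O + attachTop g hs O
    stackSumBlocks-∷ g hs []      = sym (+-identityʳ _)
    stackSumBlocks-∷ g hs (B ∷ O) = trans (+-cong (*-cong refl (stackSumBlocks-∷ g hs O)) refl) (rearrange _ _ _ _ _ _)
      where
      rearrange : ∀ f g₀ k t gB a → f * (g₀ * k + t) + (gB * k + g₀ * a) ≈ g₀ * (f * k + a) + (gB * k + f * t)
      rearrange = solve 6 (λ f g₀ k t gB a → f :* (g₀ :* k :+ t) :+ (gB :* k :+ g₀ :* a)
                                          := g₀ :* (f :* k :+ a) :+ (gB :* k :+ f :* t)) refl

    joinOuter-stackSumBlocks : ∀ hs y O → joinOuter (stackSumBlocks hs) y O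
                                        ≈ attachTop (opened (proj₂ y)) hs O + attachJoined hs y O
    joinOuter-stackSumBlocks hs y []      = sym (+-identityˡ _)
    joinOuter-stackSumBlocks hs y (B ∷ O) =
      trans (+-cong refl (*-cong refl (joinOuter-stackSumBlocks hs y O))) (rearrange _ _ _ _ _)
      where
      rearrange : ∀ a b f d e → (a + b) + f * (d + e) ≈ (a + f * d) + (b + f * e)
      rearrange = solve 5 (λ a b f d e → (a :+ b) :+ f :* (d :+ e) := (a :+ f :* d) :+ (b :+ f :* e)) refl

    attachJoined-[] : ∀ y O → attachJoined [] y O ≈ 0#
    attachJoined-[] y []      = refl
    attachJoined-[] y (B ∷ O) = trans (+-cong refl (*-cong refl (attachJoined-[] y O))) (trans (+-identityˡ _) (zeroʳ _))

    attachJoined-∷ : ∀ h hs y O → attachJoined (h ∷ hs) y O ≈ attachTop (h ▹ proj₂ y) hs O + h [] * attachJoined hs y O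
    attachJoined-∷ h hs y []      = sym (trans (+-identityˡ _) (zeroʳ _))
    attachJoined-∷ h hs y (B ∷ O) = trans (+-cong refl (*-cong refl (attachJoined-∷ h hs y O))) (rearrange _ _ _ _ _ _)
      where
      rearrange : ∀ a h₀ c f e d → (a + h₀ * c) + f * (e + h₀ * d) ≈ (a + f * e) + h₀ * (c + f * d)
      rearrange = solve 6 (λ a h₀ c f e d → (a :+ h₀ :* c) :+ f :* (e :+ h₀ :* d)
                                         := (a :+ f :* e) :+ h₀ :* (c :+ f :* d)) refl

    joinOpen-stackSumBlocks : ∀ hs y O → joinOpen (λ ks → stackSumBlocks ks O) (proj₂ y) hs
                                       ≈ attachBlock hs [ y ] O + attachJoined hs y O
    joinOpen-stackSumBlocks []       y O = sym (trans (+-identityˡ _) (attachJoined-[] y O))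
    joinOpen-stackSumBlocks (h ∷ hs) y O =
      trans (+-cong (stackSumBlocks-∷ _ hs O) (*-cong refl (joinOpen-stackSumBlocks hs y O)))
            (trans (rearrange _ _ _ _ _ _) (+-cong refl (sym (attachJoined-∷ h hs y O))))
      where
      rearrange : ∀ a k t h₀ b c → (a * k + t) + h₀ * (b + c) ≈ (a * k + h₀ * b) + (t + h₀ * c)
      rearrange = solve 6 (λ a k t h₀ b c → (a :* k :+ t) :+ h₀ :* (b :+ c) := (a :* k :+ h₀ :* b) :+ (t :+ h₀ :* c)) refl

  prepend-stackSumBlocks : ∀ hs y O → prepend y (stackSumBlocks hs) O
    ≈ stackSumBlocks (opened (proj₂ y) ∷ hs) O + joinOpen (λ ks → stackSumBlocks ks O) (proj₂ y) hs
  prepend-stackSumBlocks hs y O = begin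
    prepend y (stackSumBlocks hs) O
      ≈⟨ +-cong refl (joinOuter-stackSumBlocks hs y O) ⟩
    (g [] * stackSumBlocks hs O + attachBlock hs [ y ] O) + (attachTop g hs O + attachJoined hs y O)
      ≈⟨ interchange _ _ _ _ ⟩
    (g [] * stackSumBlocks hs O + attachTop g hs O) + (attachBlock hs [ y ] O + attachJoined hs y O)
      ≈⟨ +-cong (sym (stackSumBlocks-∷ g hs O)) (sym (joinOpen-stackSumBlocks hs y O)) ⟩
    stackSumBlocks (g ∷ hs) O + joinOpen (λ ks → stackSumBlocks ks O) (proj₂ y) hs ∎
    where
    g = opened (proj₂ y)
    open import Algebra.Properties.CommutativeSemigroup +-commutativeSemigroup using (interchange)

  innerWeight : List Bool → Partition → Carrier
  innerWeight (true  ∷ fl) (B ∷ p) = innerWeight fl p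
  innerWeight (false ∷ fl) (B ∷ p) = F (letters B) * innerWeight fl p
  innerWeight _            _       = 1#

  outerBlocks : List Bool → Partition → Partition
  outerBlocks (true  ∷ fl) (B ∷ p) = B ∷ outerBlocks fl p
  outerBlocks (false ∷ fl) (B ∷ p) = outerBlocks fl p
  outerBlocks _            _       = []

  splitWeight : (List Block → Carrier) → Partition → Carrier
  splitWeight k p = innerWeight (outerFlags p) p * k (outerBlocks (outerFlags p) p)

  noncrossing : List Pos → List Partition
  noncrossing L = filterB isNonCrossing (partitions L)

  ncSum : List Pos → (List Block → Carrier) → Carrier
  ncSum L k = sum (map (splitWeight k) (noncrossing L))

  ncSum-cong : ∀ L {k k′} → (∀ O → k O ≈ k′ O) → ncSum L k ≈ ncSum L k′
  ncSum-cong L k≈ = sum-map-cong (λ p → *-cong refl (k≈ _)) (noncrossing L)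

  ncSum-+ : ∀ L k k′ → ncSum L (λ O → k O + k′ O) ≈ ncSum L k + ncSum L k′
  ncSum-+ L k k′ = trans (sum-map-cong (λ p → distribˡ _ _ _) (noncrossing L)) (sum-+ _ _ (noncrossing L))

  ncSum-*ˡ : ∀ L x k → ncSum L (λ O → x * k O) ≈ x * ncSum L k
  ncSum-*ˡ L x k = trans (sum-map-cong (λ p → x∙yz≈y∙xz _ _ _) (noncrossing L)) (sum-*ˡ x _ (noncrossing L))

  ncSum-zero : ∀ L → ncSum L (λ _ → 0#) ≈ 0#
  ncSum-zero L = trans (sum-map-cong (λ p → zeroʳ _) (noncrossing L)) (sum-zero (noncrossing L))

  private
    innerWeight-plug : ∀ pre X fl post
      → innerWeight (replicate (length pre) false ++ true ∷ fl) (pre ++ X ∷ post) ≈ weight pre * innerWeight fl post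
    innerWeight-plug []      X fl post = sym (*-identityˡ _)
    innerWeight-plug (C ∷ pre) X fl post = trans (*-cong refl (innerWeight-plug pre X fl post)) (sym (*-assoc _ _ _))

    outerBlocks-plug : ∀ pre X fl post
      → outerBlocks (replicate (length pre) false ++ true ∷ fl) (pre ++ X ∷ post) ≡.≡ X ∷ outerBlocks fl post
    outerBlocks-plug []        X fl post = ≡.refl
    outerBlocks-plug (C ∷ pre) X fl post = outerBlocks-plug pre X fl post

    joinFlagged : (List Block → Carrier) → Pos → List Bool → Partition → Carrier
    joinFlagged k y (b ∷ fl) (B ∷ post) =
      (if b then innerWeight fl post * k ((y ◃ B) ∷ outerBlocks fl post) else 0#) + F (letters B) * joinFlagged k y fl post
    joinFlagged k y _        _          = 0#

    joinFlagged≈joinOuter : ∀ k y fl q → joinFlagged k y fl q ≈ innerWeight fl q * joinOuter k y (outerBlocks fl q)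
    joinFlagged≈joinOuter k y []           []         = sym (zeroʳ _)
    joinFlagged≈joinOuter k y []           (B ∷ q)    = sym (zeroʳ _)
    joinFlagged≈joinOuter k y (true ∷ fl)  []         = sym (zeroʳ _)
    joinFlagged≈joinOuter k y (false ∷ fl) []         = sym (zeroʳ _)
    joinFlagged≈joinOuter k y (true ∷ fl)  (B ∷ post) =
      trans (+-cong refl (trans (*-cong refl (joinFlagged≈joinOuter k y fl post)) (x∙yz≈y∙xz _ _ _))) (sym (distribˡ _ _ _))
    joinFlagged≈joinOuter k y (false ∷ fl) (B ∷ post) =
      trans (+-identityˡ _) (trans (*-cong refl (joinFlagged≈joinOuter k y fl post)) (sym (*-assoc _ _ _)))

    plugTerm : (List Block → Carrier) → Pos → Partition → Split → Carrier
    plugTerm k y pre (mid , B , post) =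
      if isOuterIn (pre ++ mid ++ post) B then splitWeight k (pre ++ mid ++ (y ◃ B) ∷ post) else 0#

    sum-plugTerm : ∀ k y pre rest → All (Above (proj₁ y)) (pre ++ rest) → WellOrdered (pre ++ rest)
      → sum (map (plugTerm k y pre) (splits rest)) ≈ weight pre * joinFlagged k y (outerFlagsAfter pre rest) rest
    sum-plugTerm k y pre []         above wo = sym (zeroʳ _)
    sum-plugTerm k y pre (B ∷ post) above wo@(maxs , sorted) = begin
      plugTerm k y pre ([] , B , post) + sum (map (plugTerm k y pre) (map (consPrefix B) (splits post)))
        ≈⟨ +-cong first (trans (reflexive (≡.cong sum (≡.trans (≡.sym (map-∘ (splits post))) (map-cong shift (splits post)))))
                               (sum-plugTerm k y (pre ++ B ∷ []) post (≡.subst (All _) reassoc above)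
                                             (≡.subst WellOrdered reassoc wo))) ⟩
      weight pre * (if isOuterIn (pre ++ post) B then innerWeight fl post * k ((y ◃ B) ∷ outerBlocks fl post) else 0#)
        + weight (pre ++ B ∷ []) * joinFlagged k y fl post
        ≈⟨ +-cong refl (trans (*-cong (weight-∷ʳ pre B) refl) (*-assoc _ _ _)) ⟩
      weight pre * (if isOuterIn (pre ++ post) B then innerWeight fl post * k ((y ◃ B) ∷ outerBlocks fl post) else 0#)
        + weight pre * (F (letters B) * joinFlagged k y fl post)
        ≈⟨ sym (distribˡ _ _ _) ⟩
      weight pre * joinFlagged k y (outerFlagsAfter pre (B ∷ post)) (B ∷ post) ∎
      where
      fl = outerFlagsAfter (pre ++ B ∷ []) post
      reassoc : pre ++ B ∷ post ≡.≡ (pre ++ B ∷ []) ++ post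
      reassoc = ≡.sym (++-assoc pre (B ∷ []) post)
      shift : ∀ s → plugTerm k y pre (consPrefix B s) ≡.≡ plugTerm k y (pre ++ B ∷ []) s
      shift (mid , C , post′) rewrite ++-assoc pre (B ∷ []) (mid ++ post′)
                                    | ++-assoc pre (B ∷ []) (mid ++ (y ◃ C) ∷ post′) = ≡.refl
      first : plugTerm k y pre ([] , B , post)
            ≈ weight pre * (if isOuterIn (pre ++ post) B then innerWeight fl post * k ((y ◃ B) ∷ outerBlocks fl post) else 0#)
      first with isOuterIn (pre ++ post) B in outerB
      ... | false = sym (zeroʳ _)
      ... | true rewrite outerFlags-plug y B pre post above (All.lookup maxs (∈-++⁺ʳ pre (here ≡.refl)))
                           (proj₁ (AllPairs-split pre sorted)) (proj₂ (AllPairs-split pre sorted)) outerB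
                       | outerBlocks-plug pre (y ◃ B) fl post
        = trans (*-cong (innerWeight-plug pre (y ◃ B) fl post) refl) (*-assoc _ _ _)

    ifNoncrossing : (List Block → Carrier) → Partition → Carrier
    ifNoncrossing k p = if isNonCrossing p then splitWeight k p else 0#

    sum-insertions : ∀ k y q → All (Above (proj₁ y)) q → WellOrdered q
      → sum (map (ifNoncrossing k) (([ y ] ∷ q) ∷ insertEach y q)) ≈ ifNoncrossing (prepend y k) q
    sum-insertions k y q above wo rewrite isNonCrossing-singleton y q | insertEach≡plug-splits y q
      with isNonCrossing q in nc
    ... | true = begin
      splitWeight k ([ y ] ∷ q) + sum (map (ifNoncrossing k) (map (plug y) (splits q)))
        ≈⟨ +-cong (reflexive (≡.cong (λ fl → innerWeight fl ([ y ] ∷ q) * k (outerBlocks fl ([ y ] ∷ q)))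
                                     (outerFlags-singleton y q above)))
                  (trans (reflexive (≡.cong sum (≡.sym (map-∘ (splits q)))))
                         (trans (sum-map-cong-local (All.map (λ {s} → plugged s) (unsplit-splits q)))
                                (sum-plugTerm k y [] q above wo))) ⟩
      innerWeight fl q * k ([ y ] ∷ outerBlocks fl q) + 1# * joinFlagged k y fl q
        ≈⟨ +-cong refl (trans (*-identityˡ _) (joinFlagged≈joinOuter k y fl q)) ⟩
      innerWeight fl q * k ([ y ] ∷ outerBlocks fl q) + innerWeight fl q * joinOuter k y (outerBlocks fl q)
        ≈⟨ sym (distribˡ _ _ _) ⟩
      splitWeight (prepend y k) q ∎
      where
      fl = outerFlags q
      plugged : ∀ s → unsplit s ≡.≡ q → ifNoncrossing k (plug y s) ≈ plugTerm k y [] s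
      plugged (mid , B , post) ≡.refl rewrite isNonCrossing-plug y B mid post above | nc = refl
    ... | false = trans (+-identityˡ _)
      (trans (reflexive (≡.cong sum (≡.sym (map-∘ (splits q)))))
             (trans (sum-map-cong-local (All.map (λ {s} → plugged s) (unsplit-splits q))) (sum-zero (splits q))))
      where
      plugged : ∀ s → unsplit s ≡.≡ q → ifNoncrossing k (plug y s) ≈ 0#
      plugged (mid , B , post) ≡.refl rewrite isNonCrossing-plug y B mid post above | nc = refl

  ncSum-∷ : ∀ y ys k → IncreasingPositions (y ∷ ys) → ncSum (y ∷ ys) k ≈ ncSum ys (prepend y k)
  ncSum-∷ y ys k (y< ∷ inc) = begin
    ncSum (y ∷ ys) k
      ≈⟨ sum-filterB isNonCrossing (splitWeight k) (partitions (y ∷ ys)) ⟩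
    sum (map (ifNoncrossing k) (concatMap (λ q → ([ y ] ∷ q) ∷ insertEach y q) (partitions ys)))
      ≈⟨ sum-concatMap (ifNoncrossing k) (λ q → ([ y ] ∷ q) ∷ insertEach y q) (partitions ys) ⟩
    sum (map (λ q → sum (map (ifNoncrossing k) (([ y ] ∷ q) ∷ insertEach y q))) (partitions ys))
      ≈⟨ sum-map-cong-local (All.zipWith (λ {q} (above , wo) → sum-insertions k y q above wo)
                                         (partitions-above (proj₁ y) ys y< , partitions-wellOrdered ys inc)) ⟩
    sum (map (ifNoncrossing (prepend y k)) (partitions ys))
      ≈⟨ sum-filterB isNonCrossing (splitWeight (prepend y k)) (partitions ys) ⟨
    ncSum ys (prepend y k) ∎

  ncSum-stackSumBlocks : ∀ L hs → IncreasingPositions L → ncSum L (stackSumBlocks hs) ≈ stackSum hs (map proj₂ L)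
  ncSum-joinOpen : ∀ L hs z → IncreasingPositions L
    → ncSum L (λ O → joinOpen (λ ks → stackSumBlocks ks O) z hs) ≈ joinOpen (λ ks → stackSum ks (map proj₂ L)) z hs
  ncSum-stackSumBlocks []       hs _ = trans (+-identityʳ _) (*-identityˡ _)
  ncSum-stackSumBlocks (y ∷ ys) hs inc@(_ ∷ incys) = begin
    ncSum (y ∷ ys) (stackSumBlocks hs)
      ≈⟨ ncSum-∷ y ys _ inc ⟩
    ncSum ys (prepend y (stackSumBlocks hs))
      ≈⟨ ncSum-cong ys (prepend-stackSumBlocks hs y) ⟩
    ncSum ys (λ O → stackSumBlocks (opened (proj₂ y) ∷ hs) O + joinOpen (λ ks → stackSumBlocks ks O) (proj₂ y) hs)
      ≈⟨ ncSum-+ ys (stackSumBlocks (opened (proj₂ y) ∷ hs)) (λ O → joinOpen (λ ks → stackSumBlocks ks O) (proj₂ y) hs) ⟩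
    ncSum ys (stackSumBlocks (opened (proj₂ y) ∷ hs)) + ncSum ys (λ O → joinOpen (λ ks → stackSumBlocks ks O) (proj₂ y) hs)
      ≈⟨ +-cong (ncSum-stackSumBlocks ys _ incys) (ncSum-joinOpen ys hs (proj₂ y) incys) ⟩
    stackSum hs (map proj₂ (y ∷ ys)) ∎
  ncSum-joinOpen L []       z inc = ncSum-zero L
  ncSum-joinOpen L (h ∷ hs) z inc = begin
    ncSum L (λ O → stackSumBlocks ((h ▹ z) ∷ hs) O + h [] * joinRest O)
      ≈⟨ ncSum-+ L (stackSumBlocks ((h ▹ z) ∷ hs)) (λ O → h [] * joinRest O) ⟩
    ncSum L (stackSumBlocks ((h ▹ z) ∷ hs)) + ncSum L (λ O → h [] * joinRest O)
      ≈⟨ +-cong (ncSum-stackSumBlocks L _ inc) (trans (ncSum-*ˡ L (h []) joinRest) (*-cong refl (ncSum-joinOpen L hs z inc))) ⟩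
    joinOpen (λ ks → stackSum ks (map proj₂ L)) z (h ∷ hs) ∎
    where
    joinRest : List Block → Carrier
    joinRest O = joinOpen (λ ks → stackSumBlocks ks O) z hs

  private
    stackSumBlocks-[] : ∀ O → stackSumBlocks [] O ≈ weight O
    stackSumBlocks-[] []      = refl
    stackSumBlocks-[] (B ∷ O) = trans (+-identityʳ _) (*-cong refl (stackSumBlocks-[] O))

    innerWeight-outerBlocks : ∀ P q → innerWeight (outerFlagsAfter P q) q * weight (outerBlocks (outerFlagsAfter P q) q)
                                    ≈ weight q
    innerWeight-outerBlocks P []      = *-identityˡ _
    innerWeight-outerBlocks P (B ∷ q) with isOuterIn (P ++ q) B
    ... | true  = trans (x∙yz≈y∙xz _ _ _) (*-cong refl (innerWeight-outerBlocks (P ++ B ∷ []) q))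
    ... | false = trans (*-assoc _ _ _) (*-cong refl (innerWeight-outerBlocks (P ++ B ∷ []) q))

    weight≈splitWeight : ∀ p → weight p ≈ splitWeight (stackSumBlocks []) p
    weight≈splitWeight p = sym (trans (*-cong refl (stackSumBlocks-[] (outerBlocks (outerFlags p) p)))
                                      (innerWeight-outerBlocks [] p))

  noncrossingSum≈freeMoment : ∀ L → IncreasingPositions L → sum (map weight (noncrossing L)) ≈ freeMoment (map proj₂ L)
  noncrossingSum≈freeMoment L inc = begin
    sum (map weight (noncrossing L))
      ≈⟨ sum-map-cong weight≈splitWeight (noncrossing L) ⟩
    ncSum L (stackSumBlocks [])
      ≈⟨ ncSum-stackSumBlocks L [] inc ⟩
    freeMoment (map proj₂ L) ∎


module IntervalSums {c ℓ c′ ℓ′ a m} (R : CommutativeRing c ℓ) (M : Monoid a m)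
  (G : CommutativeRing c′ ℓ′) (F : List (Monoid.Carrier M) → CommutativeRing.Carrier G) where
  open import Data.List using (List; []; _∷_; _++_; map; concatMap)

  open import Data.Bool using (true; false; _∧_; if_then_else_)
  open import Data.Bool.Properties using (∧-zeroʳ)
  open import Data.Bool.ListAction using (all)
  open import Data.Nat using (ℕ; suc; _<_; _≡ᵇ_)
  open import Data.Nat.Properties using (≤-refl; <⇒≤; <-trans; <⇒≢; >⇒≢)
  open import Data.Product using (_,_; proj₁; proj₂)
  open import Data.List.NonEmpty using ([_])
  import Data.List.NonEmpty as List⁺
  open import Data.List.Properties using (++-assoc; map-∘; map-cong)
  open import Data.List.Relation.Unary.All as All using (All; []; _∷_)
  open import Data.List.Relation.Unary.All.Properties using (∷ʳ⁺)
  open import Data.List.Relation.Unary.Any using (here)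
  import Relation.Binary.PropositionalEquality as ≡
  open Setup R M using (Pos; Partition; partitions; filterB; isInterval; consecutive; insertEach; idx)
  open ListLemmas using (all-++; ≡ᵇ-refl; ≢⇒≡ᵇ≡false)
  open PartitionInsertion R M

  open CommutativeRing G
  open import Relation.Binary.Reasoning.Setoid setoid
  open RingSums G
  open Expansions G (Monoid.Carrier M)
  open Moments G (Monoid.Carrier M) F
  open PartitionWeights R M G F

  headIndex : Block → ℕ
  headIndex B = proj₁ (List⁺.head B)

  markedWeight : Weight → ℕ → Partition → Carrier
  markedWeight h n []      = 1#
  markedWeight h n (B ∷ p) = (if headIndex B ≡ᵇ n then h (letters B) else F (letters B)) * markedWeight h n p

  markedWeight-unmarked : ∀ h n q → All (λ B → n < headIndex B) q → markedWeight h n q ≈ weight q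
  markedWeight-unmarked h n []      []             = refl
  markedWeight-unmarked h n (B ∷ q) (n<B ∷ n<q) rewrite ≢⇒≡ᵇ≡false (>⇒≢ n<B) =
    *-cong refl (markedWeight-unmarked h n q n<q)

  weight≈markedWeight : ∀ n p → weight p ≈ markedWeight F n p
  weight≈markedWeight n []      = refl
  weight≈markedWeight n (B ∷ p) with headIndex B ≡ᵇ n
  ... | true  = *-cong refl (weight≈markedWeight n p)
  ... | false = *-cong refl (weight≈markedWeight n p)

  isInterval-plug : ∀ y B pre post
    → isInterval (pre ++ (y ◃ B) ∷ post) ≡.≡ isInterval (pre ++ B ∷ post) ∧ (suc (proj₁ y) ≡ᵇ headIndex B)
  isInterval-plug y B pre post
    rewrite all-++ (λ C → consecutive (idx C)) pre ((y ◃ B) ∷ post) | all-++ (λ C → consecutive (idx C)) pre (B ∷ post)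
    = rearrange (all (λ C → consecutive (idx C)) pre) (suc (proj₁ y) ≡ᵇ headIndex B) (consecutive (idx B))
                (all (λ C → consecutive (idx C)) post)
    where
    rearrange : ∀ a e b d → a ∧ ((e ∧ b) ∧ d) ≡.≡ (a ∧ (b ∧ d)) ∧ e
    rearrange = solve 4 (λ a e b d → a :* ((e :* b) :* d) := (a :* (b :* d)) :* e) ≡.refl
      where open import Data.Bool.Solver using (module ∨-∧-Solver)
            open ∨-∧-Solver

  data OneBlockStartsAt (n : ℕ) : Partition → Set a where
    here  : ∀ {B q} → headIndex B ≡.≡ n → All (λ C → n < headIndex C) q → OneBlockStartsAt n (B ∷ q)
    there : ∀ {B q} → n < headIndex B → OneBlockStartsAt n q → OneBlockStartsAt n (B ∷ q)

  private
    heads-above : ∀ {n q} → All (Above n) q → All (λ B → n < headIndex B) q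
    heads-above = All.map (λ aboveB → All.lookup aboveB (here ≡.refl))

  partitions-oneBlockStartsAt : ∀ z zs → All (λ w → proj₁ z < proj₁ w) zs
                              → All (OneBlockStartsAt (proj₁ z)) (partitions (z ∷ zs))
  partitions-oneBlockStartsAt z zs z<zs =
    All-partitions-∷ z zs (partitions-above (proj₁ z) zs z<zs) (λ above → here ≡.refl (heads-above above)) plugged
    where
    plugged : ∀ s → All (Above (proj₁ z)) (unsplit s) → OneBlockStartsAt (proj₁ z) (plug z s)
    plugged ([]      , B , post) (_ ∷ above)      = here ≡.refl (heads-above above)
    plugged (C ∷ pre , B , post) (aboveC ∷ above) = there (All.lookup aboveC (here ≡.refl)) (plugged (pre , B , post) above)

  private
    plugTerm : Weight → Pos → Partition → Split → Carrier
    plugTerm h y pre (mid , B , post) =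
      if isInterval (pre ++ mid ++ (y ◃ B) ∷ post) then markedWeight h (proj₁ y) (pre ++ mid ++ (y ◃ B) ∷ post) else 0#

    sum-plugTerm-consPrefix : ∀ h y pre B ss
      → sum (map (plugTerm h y pre) (map (consPrefix B) ss)) ≈ sum (map (plugTerm h y (pre ++ B ∷ [])) ss)
    sum-plugTerm-consPrefix h y pre B ss =
      reflexive (≡.cong sum (≡.trans (≡.sym (map-∘ ss)) (map-cong shift ss)))
      where
      shift : ∀ s → plugTerm h y pre (consPrefix B s) ≡.≡ plugTerm h y (pre ++ B ∷ []) s
      shift (mid , C , post) rewrite ++-assoc pre (B ∷ []) (mid ++ (y ◃ C) ∷ post) = ≡.refl

    markedWeight-plug : ∀ h y Z pre post → All (λ B → proj₁ y < headIndex B) pre → All (λ B → proj₁ y < headIndex B) post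
      → markedWeight h (proj₁ y) (pre ++ (y ◃ Z) ∷ post) ≈ weight pre * (h (proj₂ y ∷ letters Z) * weight post)
    markedWeight-plug h y Z []        post _           y<post rewrite ≡ᵇ-refl (proj₁ y) =
      trans (*-cong refl (markedWeight-unmarked h _ post y<post)) (sym (*-identityˡ _))
    markedWeight-plug h y Z (D ∷ pre) post (y<D ∷ y<pre) y<post rewrite ≢⇒≡ᵇ≡false (>⇒≢ y<D) =
      trans (*-cong refl (markedWeight-plug h y Z pre post y<pre y<post)) (sym (*-assoc _ _ _))

    plug-notInterval : ∀ y B pre post → (suc (proj₁ y) ≡ᵇ headIndex B) ≡.≡ false
                     → isInterval (pre ++ (y ◃ B) ∷ post) ≡.≡ false
    plug-notInterval y B pre post e≡false rewrite isInterval-plug y B pre post | e≡false = ∧-zeroʳ _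

    if-false : ∀ {b} (x : Carrier) → b ≡.≡ false → (if b then x else 0#) ≈ 0#
    if-false x ≡.refl = refl

    sum-plugTerm-late : ∀ h y pre rest → All (λ B → suc (proj₁ y) < headIndex B) rest
                      → sum (map (plugTerm h y pre) (splits rest)) ≈ 0#
    sum-plugTerm-late h y pre []         []            = refl
    sum-plugTerm-late h y pre (B ∷ post) (y<B ∷ y<post) =
      trans (+-cong (if-false _ (plug-notInterval y B pre post (≢⇒≡ᵇ≡false (<⇒≢ y<B))))
                    (trans (sum-plugTerm-consPrefix h y pre B (splits post)) (sum-plugTerm-late h y (pre ++ B ∷ []) post y<post)))
            (+-identityˡ _)

    sum-plugTerm : ∀ h y pre rest → OneBlockStartsAt (suc (proj₁ y)) rest → All (λ B → suc (proj₁ y) < headIndex B) pre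
      → isInterval (pre ++ rest) ≡.≡ true
      → sum (map (plugTerm h y pre) (splits rest)) ≈ weight pre * markedWeight (h ▹ proj₂ y) (suc (proj₁ y)) rest
    sum-plugTerm h y pre (Z ∷ post) (here Z≡ y<post) y<pre interval = begin
      plugTerm h y pre ([] , Z , post) + sum (map (plugTerm h y pre) (map (consPrefix Z) (splits post)))
        ≈⟨ +-cong first (trans (sum-plugTerm-consPrefix h y pre Z (splits post))
                               (sum-plugTerm-late h y (pre ++ Z ∷ []) post y<post)) ⟩
      weight pre * (h (proj₂ y ∷ letters Z) * weight post) + 0#
        ≈⟨ +-identityʳ _ ⟩
      weight pre * (h (proj₂ y ∷ letters Z) * weight post)
        ≈⟨ *-cong refl (*-cong (reflexive (≡.cong (λ b → if b then h (proj₂ y ∷ letters Z) else F (letters Z)) marked))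
                               (markedWeight-unmarked _ _ post y<post)) ⟨
      weight pre * markedWeight (h ▹ proj₂ y) (suc (proj₁ y)) (Z ∷ post) ∎
      where
      marked : (headIndex Z ≡ᵇ suc (proj₁ y)) ≡.≡ true
      marked rewrite Z≡ = ≡ᵇ-refl (suc (proj₁ y))
      first : plugTerm h y pre ([] , Z , post) ≈ weight pre * (h (proj₂ y ∷ letters Z) * weight post)
      starts : (suc (proj₁ y) ≡ᵇ headIndex Z) ≡.≡ true
      starts rewrite Z≡ = ≡ᵇ-refl (suc (proj₁ y))
      first rewrite isInterval-plug y Z pre post | interval | starts =
        markedWeight-plug h y Z pre post (All.map <⇒≤ y<pre) (All.map <⇒≤ y<post)
    sum-plugTerm h y pre (B ∷ q) (there y<B one) y<pre interval = begin
      plugTerm h y pre ([] , B , q) + sum (map (plugTerm h y pre) (map (consPrefix B) (splits q)))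
        ≈⟨ +-cong (if-false _ (plug-notInterval y B pre q (≢⇒≡ᵇ≡false (<⇒≢ y<B))))
                  (trans (sum-plugTerm-consPrefix h y pre B (splits q))
                         (sum-plugTerm h y (pre ++ B ∷ []) q one (∷ʳ⁺ y<pre y<B)
                                       (≡.trans (≡.cong isInterval (++-assoc pre (B ∷ []) q)) interval))) ⟩
      0# + weight (pre ++ B ∷ []) * markedWeight (h ▹ proj₂ y) (suc (proj₁ y)) q
        ≈⟨ trans (+-identityˡ _) (trans (*-cong (weight-∷ʳ pre B) refl) (*-assoc _ _ _)) ⟩
      weight pre * (F (letters B) * markedWeight (h ▹ proj₂ y) (suc (proj₁ y)) q)
        ≈⟨ *-cong refl (*-cong (reflexive (≡.cong (λ b → if b then (h ▹ proj₂ y) (letters B) else F (letters B))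
                                                  (≢⇒≡ᵇ≡false (>⇒≢ y<B)))) refl) ⟨
      weight pre * markedWeight (h ▹ proj₂ y) (suc (proj₁ y)) (B ∷ q) ∎

    ifInterval : Weight → ℕ → Partition → Carrier
    ifInterval h n p = if isInterval p then markedWeight h n p else 0#

    sum-insertions : ∀ h y q → OneBlockStartsAt (suc (proj₁ y)) q → All (λ B → proj₁ y < headIndex B) q
      → sum (map (ifInterval h (proj₁ y)) (([ y ] ∷ q) ∷ insertEach y q))
      ≈ (if isInterval q then h (proj₂ y ∷ []) * weight q + markedWeight (h ▹ proj₂ y) (suc (proj₁ y)) q else 0#)
    sum-insertions h y q one y<q rewrite insertEach≡plug-splits y q with isInterval q in interval
    ... | true rewrite ≡ᵇ-refl (proj₁ y) =
      +-cong (*-cong refl (markedWeight-unmarked h _ q y<q))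
             (trans (reflexive (≡.cong sum (≡.sym (map-∘ (splits q))))) (trans (sum-plugTerm h y [] q one [] interval) (*-identityˡ _)))
    ... | false = trans (+-identityˡ _) (trans (reflexive (≡.cong sum (≡.sym (map-∘ (splits q)))))
        (trans (sum-map-cong-local (All.map (λ {s} → plugged s) (unsplit-splits q))) (sum-zero (splits q))))
      where
      plugged : ∀ s → unsplit s ≡.≡ q → ifInterval h (proj₁ y) (plug y s) ≈ 0#
      plugged (pre , B , post) ≡.refl rewrite isInterval-plug y B pre post | interval = refl

  intervalPartitions : List Pos → List Partition
  intervalPartitions L = filterB isInterval (partitions L)

  markedSum : Weight → Pos → List Pos → Carrier
  markedSum h y ys = sum (map (markedWeight h (proj₁ y)) (intervalPartitions (y ∷ ys)))

  -- Either y is a singleton block, or it joins the block of the next position z.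
  markedSum-∷ : ∀ h y z zs → proj₁ z ≡.≡ suc (proj₁ y) → All (λ w → proj₁ z < proj₁ w) zs
    → markedSum h y (z ∷ zs) ≈ h (proj₂ y ∷ []) * sum (map weight (intervalPartitions (z ∷ zs))) + markedSum (h ▹ proj₂ y) z zs
  markedSum-∷ h y z zs z≡ z<zs = begin
    markedSum h y (z ∷ zs)
      ≈⟨ sum-filterB isInterval (markedWeight h (proj₁ y)) (partitions (y ∷ z ∷ zs)) ⟩
    sum (map (ifInterval h (proj₁ y)) (concatMap (λ q → ([ y ] ∷ q) ∷ insertEach y q) (partitions (z ∷ zs))))
      ≈⟨ sum-concatMap (ifInterval h (proj₁ y)) (λ q → ([ y ] ∷ q) ∷ insertEach y q) (partitions (z ∷ zs)) ⟩
    sum (map (λ q → sum (map (ifInterval h (proj₁ y)) (([ y ] ∷ q) ∷ insertEach y q))) (partitions (z ∷ zs)))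
      ≈⟨ sum-map-cong-local (All.zipWith (λ {q} (one , above) → sum-insertions h y q (≡.subst (λ n → OneBlockStartsAt n q) z≡ one)
                                                                                 (heads-above above))
           (partitions-oneBlockStartsAt z zs z<zs , partitions-above (proj₁ y) (z ∷ zs) (y<z ∷ All.map (<-trans y<z) z<zs))) ⟩
    sum (map (λ q → if isInterval q then h (proj₂ y ∷ []) * weight q + markedWeight (h ▹ proj₂ y) (suc (proj₁ y)) q else 0#)
             (partitions (z ∷ zs)))
      ≈⟨ sum-filterB isInterval _ (partitions (z ∷ zs)) ⟨
    sum (map (λ q → h (proj₂ y ∷ []) * weight q + markedWeight (h ▹ proj₂ y) (suc (proj₁ y)) q) (intervalPartitions (z ∷ zs)))
      ≈⟨ sum-+ _ _ (intervalPartitions (z ∷ zs)) ⟩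
    sum (map (λ q → h (proj₂ y ∷ []) * weight q) (intervalPartitions (z ∷ zs)))
      + sum (map (markedWeight (h ▹ proj₂ y) (suc (proj₁ y))) (intervalPartitions (z ∷ zs)))
      ≈⟨ +-cong (sum-*ˡ (h (proj₂ y ∷ [])) weight (intervalPartitions (z ∷ zs)))
                (reflexive (≡.cong (λ n → sum (map (markedWeight (h ▹ proj₂ y) n) (intervalPartitions (z ∷ zs)))) (≡.sym z≡))) ⟩
    h (proj₂ y ∷ []) * sum (map weight (intervalPartitions (z ∷ zs))) + markedSum (h ▹ proj₂ y) z zs ∎
    where
    y<z : proj₁ y < proj₁ z
    y<z rewrite z≡ = ≤-refl

  markedSum-[] : ∀ h y → markedSum h y [] ≈ h (proj₂ y ∷ [])
  markedSum-[] h y rewrite ≡ᵇ-refl (proj₁ y) = trans (+-identityʳ _) (*-identityʳ _)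

  markedSum≈booleanMomentWith : ∀ {k} y ys → Consecutive k (y ∷ ys)
    → ∀ h → markedSum h y ys ≈ booleanMomentWith (h ▹ proj₂ y) (map proj₂ ys)
  intervalSum≈booleanMoment : ∀ {k} L → Consecutive k L
    → sum (map weight (intervalPartitions L)) ≈ booleanMoment (map proj₂ L)

  markedSum≈booleanMomentWith y []       _                          h = markedSum-[] h y
  markedSum≈booleanMomentWith y (z ∷ zs) (y≡k ∷ c@(z≡1+k ∷ c′)) h = begin
    markedSum h y (z ∷ zs)
      ≈⟨ markedSum-∷ h y z zs (≡.trans z≡1+k (≡.cong suc (≡.sym y≡k)))
                     (≡.subst (λ n → All (λ w → n < proj₁ w) zs) (≡.sym z≡1+k) (Consecutive-≥ c′)) ⟩
    h (proj₂ y ∷ []) * sum (map weight (intervalPartitions (z ∷ zs))) + markedSum (h ▹ proj₂ y) z zs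
      ≈⟨ +-cong (*-cong refl (intervalSum≈booleanMoment (z ∷ zs) c)) (markedSum≈booleanMomentWith z zs c (h ▹ proj₂ y)) ⟩
    booleanMomentWith (h ▹ proj₂ y) (map proj₂ (z ∷ zs)) ∎

  intervalSum≈booleanMoment []       [] = +-identityʳ _
  intervalSum≈booleanMoment (y ∷ ys) c  =
    trans (sum-map-cong (weight≈markedWeight (proj₁ y)) (intervalPartitions (y ∷ ys))) (markedSum≈booleanMomentWith y ys c F)


module HalfShuffles {c ℓ a m} (R : CommutativeRing c ℓ) (M : Monoid a m)
  (φ φ′ : Monoid.Carrier M → CommutativeRing.Carrier R) where

  open import Data.Bool using (Bool; true; false)
  open import Data.Nat using (suc)
  open import Data.Product using (_,_; proj₁; proj₂; ∃₂)
  open import Data.List using (List; []; _∷_; _++_; map; length)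
  open import Data.List.Properties using (map-++; map-∘; ++-identityʳ; ++-assoc)
  open import Data.List.NonEmpty using (_∷_)
  import Relation.Binary.PropositionalEquality as ≡
  open Setup R M
  open Ext φ φ′
  open DualNumbers R M using (dualRing)
  open CommutativeRing dualRing using (_≈_; _+_; _*_; 0#; refl; sym; trans; reflexive; +-cong; *-cong;
    +-identityˡ; +-identityʳ; *-identityˡ; *-comm; zeroʳ; setoid; *-commutativeSemigroup)
  open import Algebra.Properties.CommutativeSemigroup *-commutativeSemigroup using (x∙yz≈y∙xz)
  open import Relation.Binary.Reasoning.Setoid setoid
  open RingSums dualRing
  open Expansions dualRing (Monoid.Carrier M)

  Φ̃-word : Weight
  Φ̃-word J = Φ̃ (close J)

  Φ̃-close-++ : ∀ J x → Φ̃ (close J ++ x) ≈ Φ̃-word J * Φ̃ x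
  Φ̃-close-++ []       x = sym (*-identityˡ _)
  Φ̃-close-++ (y ∷ ys) x = solve 2 (λ a b → a :* b := (a :* con 1) :* b) R.refl _ _
                        , solve 4 (λ a b c d → a :* b :+ c :* d := (a :* con 1) :* b :+ ((a :* con 0) :+ (c :* con 1)) :* d)
                                R.refl _ _ _ _
    where
    module R = CommutativeRing R
    open import Algebra.Solver.Ring.NaturalCoefficients.Default R.commutativeSemiring

  private
    Δ-unit : ∀ ts → mulTerms ts (([] , []) ∷ []) ≡.≡ ts
    Δ-unit []               = ≡.refl
    Δ-unit ((t₁ , t₂) ∷ ts) = ≡.cong₂ _∷_ (≡.cong₂ _,_ (++-identityʳ t₁) (++-identityʳ t₂)) (Δ-unit ts)

    sum-masks : ∀ n (f : List Bool → CommutativeRing.Carrier dualRing)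
              → sum (map f (masks (suc n))) ≈ sum (map (λ S → f (true ∷ S)) (masks n)) + sum (map (λ S → f (false ∷ S)) (masks n))
    sum-masks n f = begin
      sum (map f (map (true ∷_) (masks n) ++ map (false ∷_) (masks n)))
        ≈⟨ reflexive (≡.cong sum (map-++ f (map (true ∷_) (masks n)) _)) ⟩
      sum (map f (map (true ∷_) (masks n)) ++ map f (map (false ∷_) (masks n)))
        ≈⟨ sum-++ (map f (map (true ∷_) (masks n))) _ ⟩
      sum (map f (map (true ∷_) (masks n))) + sum (map f (map (false ∷_) (masks n)))
        ≈⟨ reflexive (≡.cong₂ (λ u v → sum u + sum v) (≡.sym (map-∘ (masks n))) (≡.sym (map-∘ (masks n)))) ⟩
      sum (map (λ S → f (true ∷ S)) (masks n)) + sum (map (λ S → f (false ∷ S)) (masks n)) ∎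

    ≺-masks : ∀ (h : Weight) cur xs
      → sum (map (λ S → h (sel S xs) * Φ̃ (runsAcc cur S xs)) (masks (length xs)))
      ≈ firstBlockExpansion Φ̃-word (λ J → Φ̃-word (cur ++ J)) h xs
    ≺-masks h cur []       = trans (+-identityʳ _) (*-cong refl (reflexive (≡.cong Φ̃-word (≡.sym (++-identityʳ cur)))))
    ≺-masks h cur (z ∷ zs) = trans (sum-masks (length zs) _) (+-cong
      (begin
        sum (map (λ S → h (z ∷ sel S zs) * Φ̃ (close cur ++ runsAcc [] S zs)) (masks (length zs)))
          ≈⟨ sum-map-cong (λ S → trans (*-cong refl (Φ̃-close-++ cur (runsAcc [] S zs))) (x∙yz≈y∙xz _ _ _)) (masks (length zs)) ⟩
        sum (map (λ S → Φ̃-word cur * ((h ▹ z) (sel S zs) * Φ̃ (runsAcc [] S zs))) (masks (length zs)))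
          ≈⟨ sum-*ˡ (Φ̃-word cur) _ (masks (length zs)) ⟩
        Φ̃-word cur * sum (map (λ S → (h ▹ z) (sel S zs) * Φ̃ (runsAcc [] S zs)) (masks (length zs)))
          ≈⟨ *-cong (reflexive (≡.cong Φ̃-word (≡.sym (++-identityʳ cur)))) (≺-masks (h ▹ z) [] zs) ⟩
        Φ̃-word (cur ++ []) * firstBlockExpansion Φ̃-word Φ̃-word (h ▹ z) zs ∎)
      (trans (≺-masks h (cur ++ z ∷ []) zs)
             (firstBlockExpansion-cong h zs (λ _ → refl) (λ J → reflexive (≡.cong Φ̃-word (++-assoc cur (z ∷ []) J))))))

  ≺-word : ∀ (κ : H → 𝔾) x xs
         → (κ ≺ Φ̃) ((x ∷ xs) ∷ []) ≈ firstBlockExpansion Φ̃-word Φ̃-word (λ u → κ ((x ∷ u) ∷ [])) xs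
  ≺-word κ x xs = begin
    convWith (mulTerms (Δ≺w (x ∷ xs)) (([] , []) ∷ [])) κ Φ̃
      ≈⟨ reflexive (≡.cong (λ ts → convWith ts κ Φ̃) (Δ-unit (Δ≺w (x ∷ xs)))) ⟩
    sum (map (λ t → κ (proj₁ t) * Φ̃ (proj₂ t)) (map (λ S → term (true ∷ S) (x ∷ xs)) (masks (length xs))))
      ≈⟨ reflexive (≡.cong sum (≡.sym (map-∘ (masks (length xs))))) ⟩
    sum (map (λ S → κ ((x ∷ sel S xs) ∷ []) * Φ̃ (runsAcc [] S xs)) (masks (length xs)))
      ≈⟨ ≺-masks (λ u → κ ((x ∷ u) ∷ [])) [] xs ⟩
    firstBlockExpansion Φ̃-word Φ̃-word (λ u → κ ((x ∷ u) ∷ [])) xs ∎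

  module _ (β : H → 𝔾) (βinf : IsInfChar β) where
    private
      runsAcc-nonempty : ∀ y ys S zs → ∃₂ λ w ws → runsAcc (y ∷ ys) S zs ≡.≡ w ∷ ws
      runsAcc-nonempty y ys []          zs       = _ , _ , ≡.refl
      runsAcc-nonempty y ys (true ∷ S)  []       = _ , _ , ≡.refl
      runsAcc-nonempty y ys (false ∷ S) []       = _ , _ , ≡.refl
      runsAcc-nonempty y ys (true ∷ S)  (z ∷ zs) = _ , _ , ≡.refl
      runsAcc-nonempty y ys (false ∷ S) (z ∷ zs) = runsAcc-nonempty y (ys ++ z ∷ []) S zs

      -- Unless S takes all letters, β is applied to a product of at least two words.
      ≻-masks-full : ∀ zs (g : Weight) (W : Word)
        → sum (map (λ S → g (sel S zs) * β (W ∷ runsAcc [] S zs)) (masks (length zs))) ≈ g zs * β (W ∷ [])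
      ≻-masks-full []       g W = +-identityʳ _
      ≻-masks-full (z ∷ zs) g W = trans (sum-masks (length zs) _)
        (trans (+-cong (≻-masks-full zs (g ▹ z) W)
                       (trans (sum-map-cong vanishes (masks (length zs))) (sum-zero (masks (length zs)))))
               (+-identityʳ _))
        where
        vanishes : ∀ S → g (sel S zs) * β (W ∷ runsAcc (z ∷ []) S zs) ≈ 0#
        vanishes S with runsAcc-nonempty z [] S zs
        ... | w , ws , runs≡ =
          trans (*-cong refl (trans (reflexive (≡.cong (λ r → β (W ∷ r)) runs≡)) (proj₂ βinf W w ws))) (zeroʳ _)

      ≻-masks : ∀ y ys xs
        → sum (map (λ S → Φ̃ (close (sel S xs)) * β (runsAcc (y ∷ ys) S xs)) (masks (length xs)))
        ≈ firstIntervalExpansion Φ̃-word (λ u → β ((y ∷ (ys ++ u)) ∷ [])) xs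
      ≻-masks y ys []       = trans (+-identityʳ _) (trans (*-identityˡ _)
                                (reflexive (≡.cong (λ l → β ((y ∷ l) ∷ [])) (≡.sym (++-identityʳ ys)))))
      ≻-masks y ys (z ∷ zs) = trans (sum-masks (length zs) _) (+-cong
        (trans (≻-masks-full zs (λ u → Φ̃-word (z ∷ u)) (y ∷ ys))
               (trans (*-comm _ _) (*-cong (reflexive (≡.cong (λ l → β ((y ∷ l) ∷ [])) (≡.sym (++-identityʳ ys)))) refl)))
        (trans (≻-masks y (ys ++ z ∷ []) zs)
               (firstIntervalExpansion-cong zs (λ _ → refl)
                  (λ u → reflexive (≡.cong (λ l → β ((y ∷ l) ∷ [])) (++-assoc ys (z ∷ []) u))))))

    ≻-word : ∀ x xs → (Φ̃ ≻ β) ((x ∷ xs) ∷ []) ≈ firstIntervalExpansion Φ̃-word (λ u → β ((x ∷ u) ∷ [])) xs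
    ≻-word x xs = begin
      convWith (mulTerms (Δ≻w (x ∷ xs)) (([] , []) ∷ [])) Φ̃ β
        ≈⟨ reflexive (≡.cong (λ ts → convWith ts Φ̃ β) (Δ-unit (Δ≻w (x ∷ xs)))) ⟩
      sum (map (λ t → Φ̃ (proj₁ t) * β (proj₂ t)) (map (λ S → term (false ∷ S) (x ∷ xs)) (masks (length xs))))
        ≈⟨ reflexive (≡.cong sum (≡.sym (map-∘ (masks (length xs))))) ⟩
      sum (map (λ S → Φ̃ (close (sel S xs)) * β (runsAcc (x ∷ []) S xs)) (masks (length xs)))
        ≈⟨ ≻-masks x [] xs ⟩
      firstIntervalExpansion Φ̃-word (λ u → β ((x ∷ u) ∷ [])) xs ∎


module DualCumulants {c ℓ a m} (R : CommutativeRing c ℓ) (M : Monoid a m)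
  (φ φ′ : Monoid.Carrier M → CommutativeRing.Carrier R) where

  open import Data.Product using (_,_; proj₁; proj₂)
  open import Data.List using (List; []; _∷_; map)
  open import Data.List.NonEmpty using (_∷_)
  import Relation.Binary.PropositionalEquality as ≡
  open Setup R M
  open Ext φ φ′
  open Cumulants φ φ′
  open DualNumbers R M using (dualRing)
  module R = CommutativeRing R
  open RingSums dualRing using (sum)

  cumulantWeight : (Word → R.Carrier) → (Word → R.Carrier) → List (Monoid.Carrier M) → 𝔾
  cumulantWeight κ κ′ []       = 0𝔾
  cumulantWeight κ κ′ (x ∷ xs) = (κ (x ∷ xs) , κ′ (x ∷ xs))

  module _ (κ κ′ : Word → R.Carrier) where
    open PartitionWeights R M dualRing (cumulantWeight κ κ′) using (weight)

    private
      weight-proj₁ : ∀ π → proj₁ (weight π) ≡.≡ prodπ κ π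
      weight-proj₁ []       = ≡.refl
      weight-proj₁ (V ∷ Vs) = ≡.cong (κ (sub V) R.*_) (weight-proj₁ Vs)

      -- The derivation rule for ∂ f_π is the ħ-component of the product in 𝔾.
      weight-proj₂ : ∀ π → proj₂ (weight π) R.≈ dprodπ κ κ′ π
      weight-proj₂ []       = R.refl
      weight-proj₂ (V ∷ Vs) =
        R.trans (R.+-cong (R.*-cong R.refl (weight-proj₂ Vs)) (R.reflexive (≡.cong (κ′ (sub V) R.*_) (weight-proj₁ Vs))))
                (R.+-comm _ _)

      sum-proj₁ : ∀ πs → proj₁ (sum (map weight πs)) ≡.≡ sumℝ (map (prodπ κ) πs)
      sum-proj₁ []       = ≡.refl
      sum-proj₁ (π ∷ πs) = ≡.cong₂ R._+_ (weight-proj₁ π) (sum-proj₁ πs)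

      sum-proj₂ : ∀ πs → proj₂ (sum (map weight πs)) R.≈ sumℝ (map (dprodπ κ κ′) πs)
      sum-proj₂ []       = R.refl
      sum-proj₂ (π ∷ πs) = R.+-cong (weight-proj₂ π) (sum-proj₂ πs)

    Φ̃≈sum-weight : (Ps : Word → List Partition)
      → (∀ w → φ (prodA w) R.≈ sumℝ (map (prodπ κ) (Ps w))) → (∀ w → φ′ (prodA w) R.≈ sumℝ (map (dprodπ κ κ′) (Ps w)))
      → ∀ w → Φ̃ (w ∷ []) ≈𝔾 sum (map weight (Ps w))
    Φ̃≈sum-weight Ps moments moments′ w =
        R.trans (R.*-identityʳ _) (R.trans (moments w) (R.reflexive (≡.sym (sum-proj₁ (Ps w)))))
      , R.trans (solve 2 (λ x y → x :* con 0 :+ y :* con 1 := y) R.refl _ _) (R.trans (moments′ w) (R.sym (sum-proj₂ (Ps w))))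
      where open import Algebra.Solver.Ring.NaturalCoefficients.Default R.commutativeSemiring


module Labelling {c ℓ a m} (R : CommutativeRing c ℓ) (M : Monoid a m) where
  open import Data.Nat using (ℕ; suc; _+_)
  open import Data.Nat.Properties using (+-identityʳ; +-suc)
  open import Data.List using (map; length; zip; applyUpTo)
  open import Data.List.NonEmpty using (toList)
  open import Function using (_∘_)
  import Relation.Binary.PropositionalEquality as ≡
  open Setup R M using (labelled)
  open PartitionInsertion R M using (Consecutive; []; _∷_)

  private
    zip-consecutive : ∀ f k (xs : List (Monoid.Carrier M)) → (∀ i → f i ≡.≡ k + i)
                    → Consecutive k (zip (applyUpTo f (length xs)) xs)
    zip-consecutive f k []       _  = []
    zip-consecutive f k (x ∷ xs) f≡ = ≡.trans (f≡ 0) (+-identityʳ k)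
      ∷ zip-consecutive (f ∘ suc) (suc k) xs (λ i → ≡.trans (f≡ (suc i)) (+-suc k i))

    map-proj₂-zip : ∀ (f : ℕ → ℕ) (xs : List (Monoid.Carrier M)) → map proj₂ (zip (applyUpTo f (length xs)) xs) ≡.≡ xs
    map-proj₂-zip f []       = ≡.refl
    map-proj₂-zip f (x ∷ xs) = ≡.cong (x ∷_) (map-proj₂-zip (f ∘ suc) xs)

  labelled-consecutive : ∀ w → Consecutive 0 (labelled w)
  labelled-consecutive w = zip-consecutive (λ i → i) 0 (toList w) (λ i → ≡.refl)

  letters-labelled : ∀ w → map proj₂ (labelled w) ≡.≡ toList w
  letters-labelled w = map-proj₂-zip (λ i → i) (toList w)


module HalfShuffleSolutions {c ℓ a m} (R : CommutativeRing c ℓ) (M : Monoid a m)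
  (φ φ′ : Monoid.Carrier M → CommutativeRing.Carrier R) where
  open import Data.List using (map)
  open import Data.List.NonEmpty using (_∷_)
  import Relation.Binary.PropositionalEquality as ≡
  open CommutativeRing R using () renaming (Carrier to ℝ)
  open Setup R M
  open Ext φ φ′
  open Cumulants φ φ′
  open DualNumbers R M using (dualRing)
  open CommutativeRing dualRing using (_≈_; refl; sym; reflexive; +-identityˡ; setoid)
  open import Relation.Binary.Reasoning.Setoid setoid
  open Expansions dualRing (Monoid.Carrier M)
  open HalfShuffles R M φ φ′
  open DualCumulants R M φ φ′
  open Labelling R M
  open PartitionInsertion R M using (Consecutive⇒IncreasingPositions)

  κ̃≈free-cumulants : (κ̃ : H → 𝔾) → (∀ x → Φ̃ x ≈𝔾 (ε̃ x +𝔾 (κ̃ ≺ Φ̃) x))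
    → (r r′ : Word → ℝ) → IsFreeCumulants r → IsInfFreeCumulants r r′ → ∀ w → κ̃ (w ∷ []) ≈ (r w , r′ w)
  κ̃≈free-cumulants κ̃ fixed r r′ free free′ (x ∷ xs) =
    firstBlockExpansion-determines Φ̃-word (λ y u → κ̃ ((y ∷ u) ∷ [])) opened refl expansions≈ x xs
    where
    open Moments dualRing (Monoid.Carrier M) (cumulantWeight r r′) using (freeMoment; opened; freeMoment-firstBlock)
    open NoncrossingSums R M dualRing (cumulantWeight r r′) using (noncrossingSum≈freeMoment)

    Φ̃-word≈freeMoment : ∀ J → Φ̃-word J ≈ freeMoment J
    Φ̃-word≈freeMoment []       = refl
    Φ̃-word≈freeMoment (y ∷ ys) = begin
      Φ̃ (w ∷ [])                              ≈⟨ Φ̃≈sum-weight r r′ NC free free′ w ⟩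
      _                                       ≈⟨ noncrossingSum≈freeMoment (labelled w)
                                                    (Consecutive⇒IncreasingPositions (labelled-consecutive w)) ⟩
      freeMoment (map proj₂ (labelled w))     ≈⟨ reflexive (≡.cong freeMoment (letters-labelled w)) ⟩
      freeMoment (y ∷ ys)                     ∎
      where w = y ∷ ys

    expansions≈ : ∀ y ys → firstBlockExpansion Φ̃-word Φ̃-word (λ u → κ̃ ((y ∷ u) ∷ [])) ys
                         ≈ firstBlockExpansion Φ̃-word Φ̃-word (opened y) ys
    expansions≈ y ys = begin
      firstBlockExpansion Φ̃-word Φ̃-word (λ u → κ̃ ((y ∷ u) ∷ [])) ys ≈⟨ ≺-word κ̃ y ys ⟨
      (κ̃ ≺ Φ̃) ((y ∷ ys) ∷ [])                                       ≈⟨ +-identityˡ _ ⟨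
      ε̃ ((y ∷ ys) ∷ []) +𝔾 (κ̃ ≺ Φ̃) ((y ∷ ys) ∷ [])                  ≈⟨ fixed ((y ∷ ys) ∷ []) ⟨
      Φ̃-word (y ∷ ys)                                              ≈⟨ Φ̃-word≈freeMoment (y ∷ ys) ⟩
      freeMoment (y ∷ ys)                                          ≈⟨ freeMoment-firstBlock y ys ⟩
      firstBlockExpansion freeMoment freeMoment (opened y) ys
        ≈⟨ firstBlockExpansion-cong (opened y) ys (λ J → sym (Φ̃-word≈freeMoment J)) (λ J → sym (Φ̃-word≈freeMoment J)) ⟩
      firstBlockExpansion Φ̃-word Φ̃-word (opened y) ys              ∎

  β̃≈boolean-cumulants : (β̃ : H → 𝔾) → IsInfChar β̃ → (∀ x → Φ̃ x ≈𝔾 (ε̃ x +𝔾 (Φ̃ ≻ β̃) x))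
    → (b b′ : Word → ℝ) → IsBooleanCumulants b → IsInfBooleanCumulants b b′ → ∀ w → β̃ (w ∷ []) ≈ (b w , b′ w)
  β̃≈boolean-cumulants β̃ infinitesimal fixed b b′ boolean boolean′ (x ∷ xs) =
    firstIntervalExpansion-determines Φ̃-word (λ y u → β̃ ((y ∷ u) ∷ [])) opened expansions≈ x xs
    where
    open Moments dualRing (Monoid.Carrier M) (cumulantWeight b b′)
      using (booleanMoment; opened; booleanMomentWith-firstInterval)
    open IntervalSums R M dualRing (cumulantWeight b b′) using (intervalSum≈booleanMoment)

    Φ̃-word≈booleanMoment : ∀ J → Φ̃-word J ≈ booleanMoment J
    Φ̃-word≈booleanMoment []       = refl
    Φ̃-word≈booleanMoment (y ∷ ys) = begin
      Φ̃ (w ∷ [])                              ≈⟨ Φ̃≈sum-weight b b′ 𝓘 boolean boolean′ w ⟩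
      _                                       ≈⟨ intervalSum≈booleanMoment (labelled w) (labelled-consecutive w) ⟩
      booleanMoment (map proj₂ (labelled w))  ≈⟨ reflexive (≡.cong booleanMoment (letters-labelled w)) ⟩
      booleanMoment (y ∷ ys)                  ∎
      where w = y ∷ ys

    expansions≈ : ∀ y ys → firstIntervalExpansion Φ̃-word (λ u → β̃ ((y ∷ u) ∷ [])) ys
                         ≈ firstIntervalExpansion Φ̃-word (opened y) ys
    expansions≈ y ys = begin
      firstIntervalExpansion Φ̃-word (λ u → β̃ ((y ∷ u) ∷ [])) ys ≈⟨ ≻-word β̃ infinitesimal y ys ⟨
      (Φ̃ ≻ β̃) ((y ∷ ys) ∷ [])                                  ≈⟨ +-identityˡ _ ⟨
      ε̃ ((y ∷ ys) ∷ []) +𝔾 (Φ̃ ≻ β̃) ((y ∷ ys) ∷ [])             ≈⟨ fixed ((y ∷ ys) ∷ []) ⟨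
      Φ̃-word (y ∷ ys)                                         ≈⟨ Φ̃-word≈booleanMoment (y ∷ ys) ⟩
      booleanMoment (y ∷ ys)                                  ≈⟨ booleanMomentWith-firstInterval (opened y) ys ⟩
      firstIntervalExpansion booleanMoment (opened y) ys
        ≈⟨ firstIntervalExpansion-cong ys (λ J → sym (Φ̃-word≈booleanMoment J)) (λ _ → refl) ⟩
      firstIntervalExpansion Φ̃-word (opened y) ys             ∎


proposition4p2 : ∀ {c ℓ a m : Level} (R : CommutativeRing c ℓ) (M : Monoid a m)
    → let open CommutativeRing R
          open Setup R M
      in (φ φ′ : Monoid.Carrier M → Carrier) → φ (Monoid.ε M) ≈ 1# → φ′ (Monoid.ε M) ≈ 0#
    → let open Ext φ φ′
          open Cumulants φ φ′
      in (κ̃ β̃ : H → 𝔾)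
    → IsInfChar κ̃ → (∀ x → Φ̃ x ≈𝔾 (ε̃ x +𝔾 (κ̃ ≺ Φ̃) x))
    → IsInfChar β̃ → (∀ x → Φ̃ x ≈𝔾 (ε̃ x +𝔾 (Φ̃ ≻ β̃) x))
    → (r r′ b b′ : Word → Carrier)
    → IsFreeCumulants r → IsInfFreeCumulants r r′
    → IsBooleanCumulants b → IsInfBooleanCumulants b b′
    → ∀ (w : Word) → (proj₂ (κ̃ (w ∷ [])) ≈ r′ w) × (proj₂ (β̃ (w ∷ [])) ≈ b′ w)
proposition4p2 R M φ φ′ _ _ κ̃ β̃ _ κ̃-fixed β̃-infinitesimal β̃-fixed r r′ b b′ free free′ boolean boolean′ w =
    proj₂ (κ̃≈free-cumulants κ̃ κ̃-fixed r r′ free free′ w)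
  , proj₂ (β̃≈boolean-cumulants β̃ β̃-infinitesimal β̃-fixed b b′ boolean boolean′ w)
  where
  open HalfShuffleSolutions R M φ φ′
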